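{- Let $a,b,c,d$ be constants (e.g. complex numbers) and let $E(x)$ be the unique formal power series solution of \[ E(x) = \frac{a}{E(x)x^2(dx^2 - bx - 1) + cx^2 + bx + 1}. \] If $H_n(E)\neq 0$ for all $n\ge 0$, then for all $n\ge 0$ \begin{align*} H_{2n+1}(E) &=a^{(n+1)^2} (c + d - a)^{n^2}B_n(a,c,d),\\ H_{2n}(E) &=(-1)^na^{n(n+1)} (c + d - a) ^{n(n-1)}B_n(a,c,d). \end{align*}
   Context: For a formal power series $A(x)=\sum_{n\ge0}a_nx^n$, the Hankel determinant is $H_n(A(x))=\det(a_{i+j})_{0\le i,j\le n-1}$, with $H_0(A(x))=1$. For constants $a,c,d$, the sequence $B_n(a,c,d)$ is defined by $B_0=1$, $B_1=c-a$, and $B_{n+1}=\beta B_n+\alpha B_{n-1}$ for $n\ge1$, where $\alpha=a(c+d-a)$ and $\beta=c-2a$. -}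

module Defs where

open import Level using (Level; _⊔_)
open import Data.Nat using (ℕ; zero; suc) renaming (_+_ to _+ℕ_)
open import Data.Fin using (Fin; zero; suc; toℕ; punchIn)
open import Data.Product using (∃)
open import Relation.Nullary using (¬_)
open import Algebra.Bundles using (CommutativeRing)

record Field (c ℓ : Level) : Set (Level.suc (c ⊔ ℓ)) where
  field
    commutativeRing : CommutativeRing c ℓ
  open CommutativeRing commutativeRing public
  field
    0≉1     : ¬ (0# ≈ 1#)
    inverse : ∀ x → ¬ (x ≈ 0#) → ∃ λ y → x * y ≈ 1#

module FieldTheory {c ℓ : Level} (F : Field c ℓ) where
  open Field F using (Carrier; _≈_; _+_; _*_; -_; _-_; 0#; 1#)

  infixr 8 _^_
  _^_ : Carrier → ℕ → Carrier
  x ^ zero  = 1#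
  x ^ suc n = x * (x ^ n)

  sumFin : ∀ n → (Fin n → Carrier) → Carrier
  sumFin zero    f = 0#
  sumFin (suc n) f = f zero + sumFin n (λ i → f (suc i))

  sign : ℕ → Carrier
  sign zero    = 1#
  sign (suc n) = - sign n

  det : ∀ n → (Fin n → Fin n → Carrier) → Carrier
  det zero    M = 1#
  det (suc n) M =
    sumFin (suc n) λ j →
      sign (toℕ j) * (M zero j * det n (λ i k → M (suc i) (punchIn j k)))

  Series : Set c
  Series = ℕ → Carrier

  convolve : ℕ → Series → Series → Carrier
  convolve zero    A B = A 0 * B 0
  convolve (suc n) A B = A 0 * B (suc n) + convolve n (λ i → A (suc i)) B

  _⊗_ : Series → Series → Series
  (A ⊗ B) n = convolve n A B

  _⊕_ : Series → Series → Series
  (A ⊕ B) n = A n + B n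

  poly : Carrier → Carrier → Carrier → Carrier → Carrier → Series
  poly p0 p1 p2 p3 p4 0 = p0
  poly p0 p1 p2 p3 p4 1 = p1
  poly p0 p1 p2 p3 p4 2 = p2
  poly p0 p1 p2 p3 p4 3 = p3
  poly p0 p1 p2 p3 p4 4 = p4
  poly p0 p1 p2 p3 p4 (suc (suc (suc (suc (suc n))))) = 0#

  constS : Carrier → Series
  constS a = poly a 0# 0# 0# 0#

  _≈ₛ_ : Series → Series → Set ℓ
  A ≈ₛ B = ∀ n → A n ≈ B n

  hankel : ℕ → Series → Carrier
  hankel n A = det n (λ i j → A (toℕ i +ℕ toℕ j))

  Bseq : Carrier → Carrier → Carrier → ℕ → Carrier
  Bseq a c d zero          = 1#
  Bseq a c d (suc zero)    = c - a
  Bseq a c d (suc (suc n)) =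
    ((c - (a + a)) * Bseq a c d (suc n)) + ((a * ((c + d) - a)) * Bseq a c d n)

module Submission where

-- Shift lemma: if A = f₀ / (1 + β x - x² G) then H_(n+1)(A) = f₀^(n+1) H_n(G); multiplying the
-- Hankel matrix of A by unitriangular Toeplitz matrices of 1 + β x - x² G and of A turns it into
-- f₀^(n+1) times a block matrix with the Hankel matrix of G in the corner.
--
-- The equation says E = a / (1 + b x - x² G) with G = (1 + b x - d x²) E - c. Then G 0 = a - c
-- and G = (a - c) / (1 - x² E′), where E′ satisfies the equation of E with (a, c, d) replaced
-- by (a - δ, c - 2δ, δ), δ = a d / (a - c). Applying the shift lemma twice gives
-- H_(k+2)(E) = a^(k+2) (a - c)^(k+1) H_k(E′). The new parameters have the same α and β, and
-- B_(n+1)(a, c, d) = (c - a) B_n(a - δ, c - 2δ, δ), so both formulas follow by induction on n.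
-- Nonvanishing of H_1 = a and H_2 = a² (a - c) at every stage keeps a ≠ 0 and a ≠ c.

open import Defs
import Level
open import Level using (Level)
open import Algebra.Bundles using (CommutativeRing)
open import Data.Nat as ℕ using (ℕ; zero; suc; _∸_)
import Data.Nat.Properties as ℕ
open import Data.Nat.Tactic.RingSolver using (solve-∀)
open import Data.Fin using (Fin; zero; suc; toℕ; punchIn; pinch; fromℕ<)
import Data.Fin.Properties as Fin
open import Data.Integer using (+_)
open import Data.Product using (_,_; proj₁; proj₂)
open import Data.Bool using (if_then_else_)
open import Function using (_∘_; const)
open import Data.Vec.Functional using (updateAt)
open import Data.Vec.Functional.Properties using (updateAt-updates; updateAt-minimal; updateAt-id-local; map-updateAt)
import Relation.Binary.PropositionalEquality as ≡
open import Relation.Binary.PropositionalEquality using (_≢_)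
open import Relation.Nullary using (yes; no; ¬_; does)
open import Relation.Nullary.Decidable using (dec-true; dec-false)

-- Algebra.Solver.Ring over an arbitrary commutative ring needs a coefficient ring with
-- negation (the library's ℕ instance cannot cancel x - x), hence this ℤ instance. The
-- optimised multiple _×_ makes the constants con (+ 0) and con (+ 1) reduce to 0# and 1#.
module IntegerCoefficients {c ℓ : Level} (R : CommutativeRing c ℓ) where
  open import Data.Integer as ℤ using (ℤ; +_; -[1+_]; _⊖_; _◃_)
  import Data.Sign as Sign
  import Data.Integer.Properties as ℤ
  open import Data.Maybe using (Maybe; just; nothing)
  open import Algebra.Solver.Ring.AlmostCommutativeRing
    using (_-Raw-AlmostCommutative⟶_; fromCommutativeRing)
  open CommutativeRing R
  open import Algebra.Properties.Ring ring
    using (-‿involutive; -0#≈0#; -‿distribˡ-*; -‿distribʳ-*; -‿+-comm)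
  open import Algebra.Properties.Semiring.Mult.TCOptimised semiring using (_×_; 1+×; ×-homo-+; ×1-homo-*)
  open import Relation.Binary.Reasoning.Setoid setoid

  ⟦_⟧ : ℤ → Carrier
  ⟦ + n ⟧      = n × 1#
  ⟦ -[1+ n ] ⟧ = - (suc n × 1#)

  ⟦⟧-homo-neg : ∀ i → ⟦ ℤ.- i ⟧ ≈ - ⟦ i ⟧
  ⟦⟧-homo-neg (+ ℕ.zero) = sym -0#≈0#
  ⟦⟧-homo-neg (+ suc n)  = refl
  ⟦⟧-homo-neg -[1+ n ]   = sym (-‿involutive _)

  ⟦⟧-homo-⊖ : ∀ m n → ⟦ m ⊖ n ⟧ ≈ m × 1# - n × 1#
  ⟦⟧-homo-⊖ m ℕ.zero = begin
    ⟦ m ⊖ 0 ⟧       ≡⟨ ≡.cong ⟦_⟧ (ℤ.⊖-≥ {m} ℕ.z≤n) ⟩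
    m × 1#          ≈⟨ sym (+-identityʳ _) ⟩
    m × 1# + 0#     ≈⟨ +-congˡ (sym -0#≈0#) ⟩
    m × 1# - 0 × 1#  ∎
  ⟦⟧-homo-⊖ ℕ.zero (suc n) = begin
    ⟦ 0 ⊖ suc n ⟧      ≡⟨ ≡.cong ⟦_⟧ (ℤ.⊖-< {0} {suc n} (ℕ.s≤s ℕ.z≤n)) ⟩
    - (suc n × 1#)     ≈⟨ sym (+-identityˡ _) ⟩
    0# - suc n × 1#    ∎
  ⟦⟧-homo-⊖ (suc m) (suc n) = begin
    ⟦ suc m ⊖ suc n ⟧                 ≡⟨ ≡.cong ⟦_⟧ (ℤ.[1+m]⊖[1+n]≡m⊖n m n) ⟩
    ⟦ m ⊖ n ⟧                         ≈⟨ ⟦⟧-homo-⊖ m n ⟩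
    M - N                             ≈⟨ sym (+-identityˡ _) ⟩
    0# + (M - N)                      ≈⟨ +-congʳ (sym (-‿inverseʳ 1#)) ⟩
    (1# - 1#) + (M - N)               ≈⟨ +-assoc _ _ _ ⟩
    1# + (- 1# + (M - N))             ≈⟨ +-congˡ (sym (+-assoc _ _ _)) ⟩
    1# + ((- 1# + M) - N)             ≈⟨ +-congˡ (+-congʳ (+-comm _ _)) ⟩
    1# + ((M - 1#) - N)               ≈⟨ +-congˡ (+-assoc _ _ _) ⟩
    1# + (M + (- 1# - N))             ≈⟨ +-congˡ (+-congˡ (-‿+-comm _ _)) ⟩
    1# + (M - (1# + N))               ≈⟨ sym (+-assoc _ _ _) ⟩
    (1# + M) - (1# + N)               ≈⟨ +-cong (sym (1+× m 1#)) (-‿cong (sym (1+× n 1#))) ⟩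
    suc m × 1# - suc n × 1#           ∎
    where M = m × 1#; N = n × 1#

  ⟦⟧-homo-+ : ∀ i j → ⟦ i ℤ.+ j ⟧ ≈ ⟦ i ⟧ + ⟦ j ⟧
  ⟦⟧-homo-+ -[1+ m ] -[1+ n ] = begin
    - (suc (suc (m ℕ.+ n)) × 1#)       ≡⟨ ≡.cong (λ k → - (k × 1#)) (≡.cong suc (≡.sym (ℕ.+-suc m n))) ⟩
    - ((suc m ℕ.+ suc n) × 1#)         ≈⟨ -‿cong (×-homo-+ 1# (suc m) (suc n)) ⟩
    - (suc m × 1# + suc n × 1#)        ≈⟨ sym (-‿+-comm _ _) ⟩
    - (suc m × 1#) + - (suc n × 1#)    ∎
  ⟦⟧-homo-+ -[1+ m ] (+ n)    = trans (⟦⟧-homo-⊖ n (suc m)) (+-comm _ _)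
  ⟦⟧-homo-+ (+ m)    -[1+ n ] = ⟦⟧-homo-⊖ m (suc n)
  ⟦⟧-homo-+ (+ m)    (+ n)    = ×-homo-+ 1# m n

  ⟦⟧-homo-* : ∀ i j → ⟦ i ℤ.* j ⟧ ≈ ⟦ i ⟧ * ⟦ j ⟧
  ⟦⟧-homo-* (+ m) (+ n) = begin
    ⟦ Sign.+ ◃ (m ℕ.* n) ⟧ ≡⟨ ≡.cong ⟦_⟧ (ℤ.+◃n≡+n (m ℕ.* n)) ⟩
    (m ℕ.* n) × 1#        ≈⟨ ×1-homo-* m n ⟩
    m × 1# * n × 1#       ∎
  ⟦⟧-homo-* (+ m) -[1+ n ] = begin
    ⟦ Sign.- ◃ (m ℕ.* suc n) ⟧   ≡⟨ ≡.cong ⟦_⟧ (ℤ.-◃n≡-n (m ℕ.* suc n)) ⟩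
    ⟦ ℤ.- + (m ℕ.* suc n) ⟧      ≈⟨ ⟦⟧-homo-neg (+ (m ℕ.* suc n)) ⟩
    - ((m ℕ.* suc n) × 1#)       ≈⟨ -‿cong (×1-homo-* m (suc n)) ⟩
    - (m × 1# * suc n × 1#)      ≈⟨ -‿distribʳ-* _ _ ⟩
    m × 1# * - (suc n × 1#)      ∎
  ⟦⟧-homo-* -[1+ m ] (+ n) = begin
    ⟦ Sign.- ◃ (suc m ℕ.* n) ⟧   ≡⟨ ≡.cong ⟦_⟧ (ℤ.-◃n≡-n (suc m ℕ.* n)) ⟩
    ⟦ ℤ.- + (suc m ℕ.* n) ⟧      ≈⟨ ⟦⟧-homo-neg (+ (suc m ℕ.* n)) ⟩
    - ((suc m ℕ.* n) × 1#)       ≈⟨ -‿cong (×1-homo-* (suc m) n) ⟩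
    - (suc m × 1# * n × 1#)      ≈⟨ -‿distribˡ-* _ _ ⟩
    - (suc m × 1#) * n × 1#      ∎
  ⟦⟧-homo-* -[1+ m ] -[1+ n ] = begin
    ⟦ Sign.+ ◃ (suc m ℕ.* suc n) ⟧      ≡⟨ ≡.cong ⟦_⟧ (ℤ.+◃n≡+n (suc m ℕ.* suc n)) ⟩
    (suc m ℕ.* suc n) × 1#              ≈⟨ ×1-homo-* (suc m) (suc n) ⟩
    M * N                               ≈⟨ sym (-‿involutive _) ⟩
    - - (M * N)                         ≈⟨ -‿cong (-‿distribˡ-* M N) ⟩
    - (- M * N)                         ≈⟨ -‿distribʳ-* _ _ ⟩
    - M * - N                           ∎
    where M = suc m × 1#; N = suc n × 1#

  homomorphism : ℤ.+-*-rawRing -Raw-AlmostCommutative⟶ fromCommutativeRing R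
  homomorphism = record
    { ⟦_⟧ = ⟦_⟧ ; +-homo = ⟦⟧-homo-+ ; *-homo = ⟦⟧-homo-* ; -‿homo = ⟦⟧-homo-neg
    ; 0-homo = refl ; 1-homo = refl }

  ⟦⟧-≟ : ∀ i j → Maybe (⟦ i ⟧ ≈ ⟦ j ⟧)
  ⟦⟧-≟ i j with i ℤ.≟ j
  ... | yes ≡.refl = just refl
  ... | no _       = nothing

  open import Algebra.Solver.Ring ℤ.+-*-rawRing (fromCommutativeRing R) homomorphism ⟦⟧-≟ public
    using (solve; _:=_; _:+_; _:*_; :-_; _:-_; con)

punchIn-punchIn-pinch : ∀ {n} (r : Fin (suc n)) (j : Fin n) → punchIn (punchIn r j) (pinch j r) ≡.≡ r
punchIn-punchIn-pinch {suc n} zero    j       = ≡.refl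
punchIn-punchIn-pinch {suc n} (suc r) zero    = ≡.refl
punchIn-punchIn-pinch {suc n} (suc r) (suc j) = ≡.cong suc (punchIn-punchIn-pinch r j)

punchIn-punchIn-punchIn-pinch : ∀ {n} (r : Fin (suc (suc n))) (j : Fin (suc n)) (k : Fin n) →
  punchIn (punchIn r j) (punchIn (pinch j r) k) ≡.≡ punchIn r (punchIn j k)
punchIn-punchIn-punchIn-pinch zero    j       k       = ≡.refl
punchIn-punchIn-punchIn-pinch (suc r) zero    k       = ≡.refl
punchIn-punchIn-punchIn-pinch {suc n} (suc r) (suc j) zero    = ≡.refl
punchIn-punchIn-punchIn-pinch {suc n} (suc r) (suc j) (suc k) =
  ≡.cong suc (punchIn-punchIn-punchIn-pinch r j k)

toℕ-pinch-+ : ∀ {n} (r : Fin (suc n)) (j : Fin n) →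
  suc (toℕ j) ℕ.+ toℕ (pinch j r) ≡.≡ toℕ r ℕ.+ toℕ (punchIn r j)
toℕ-pinch-+ {suc n} zero    j       = ≡.cong suc (ℕ.+-identityʳ _)
toℕ-pinch-+ {suc n} (suc r) zero    = ≡.cong suc (≡.sym (ℕ.+-identityʳ _))
toℕ-pinch-+ {suc n} (suc r) (suc j) = begin
  suc (suc (toℕ j)) ℕ.+ suc (toℕ (pinch j r)) ≡⟨ ≡.cong suc (ℕ.+-suc (suc (toℕ j)) _) ⟩
  suc (suc (suc (toℕ j) ℕ.+ toℕ (pinch j r))) ≡⟨ ≡.cong (λ m → suc (suc m)) (toℕ-pinch-+ r j) ⟩
  suc (suc (toℕ r ℕ.+ toℕ (punchIn r j)))     ≡⟨ ≡.cong suc (≡.sym (ℕ.+-suc (toℕ r) _)) ⟩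
  suc (toℕ r ℕ.+ suc (toℕ (punchIn r j)))     ∎
  where open ≡.≡-Reasoning

module Determinant {κ ℓ : Level} (F : Field κ ℓ) where
  open import Data.Product using (_×_)
  open Field F hiding (zero)
  open FieldTheory F
  open IntegerCoefficients commutativeRing
  open import Algebra.Properties.Ring ring using (-‿distribˡ-*)
  open import Relation.Binary.Reasoning.Setoid setoid

  Matrix : ℕ → Set κ
  Matrix n = Fin n → Fin n → Carrier

  sumFin-cong : ∀ n {f g : Fin n → Carrier} → (∀ i → f i ≈ g i) → sumFin n f ≈ sumFin n g
  sumFin-cong zero    f≈g = refl
  sumFin-cong (suc n) f≈g = +-cong (f≈g zero) (sumFin-cong n (f≈g ∘ suc))

  sumFin-zero : ∀ n {f : Fin n → Carrier} → (∀ i → f i ≈ 0#) → sumFin n f ≈ 0#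
  sumFin-zero zero    f≈0 = refl
  sumFin-zero (suc n) f≈0 = trans (+-cong (f≈0 zero) (sumFin-zero n (f≈0 ∘ suc))) (+-identityˡ 0#)

  sumFin-+ : ∀ n (f g : Fin n → Carrier) → sumFin n (λ i → f i + g i) ≈ sumFin n f + sumFin n g
  sumFin-+ zero    f g = sym (+-identityˡ 0#)
  sumFin-+ (suc n) f g = trans (+-congˡ (sumFin-+ n (f ∘ suc) (g ∘ suc))) (+-interchange _ _ _ _)
    where
    +-interchange : ∀ a b c d → (a + b) + (c + d) ≈ (a + c) + (b + d)
    +-interchange = solve 4 (λ a b c d → (a :+ b) :+ (c :+ d) := (a :+ c) :+ (b :+ d)) refl

  *-distribˡ-sumFin : ∀ n c (f : Fin n → Carrier) → c * sumFin n f ≈ sumFin n (λ i → c * f i)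
  *-distribˡ-sumFin zero    c f = zeroʳ c
  *-distribˡ-sumFin (suc n) c f = trans (distribˡ _ _ _) (+-congˡ (*-distribˡ-sumFin n c (f ∘ suc)))

  sumFin-comm : ∀ m n (f : Fin m → Fin n → Carrier) →
                sumFin m (λ i → sumFin n (f i)) ≈ sumFin n (λ j → sumFin m (λ i → f i j))
  sumFin-comm zero    n f = sym (sumFin-zero n (λ _ → refl))
  sumFin-comm (suc m) n f = trans (+-congˡ (sumFin-comm m n (f ∘ suc))) (sym (sumFin-+ n (f zero) _))

  sumFin-punchIn : ∀ n (f : Fin (suc n) → Carrier) r → sumFin (suc n) f ≈ f r + sumFin n (f ∘ punchIn r)
  sumFin-punchIn n       f zero    = refl
  sumFin-punchIn (suc n) f (suc r) = trans (+-congˡ (sumFin-punchIn n (f ∘ suc) r)) (+-exchange _ _ _)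
    where
    +-exchange : ∀ a b c → a + (b + c) ≈ b + (a + c)
    +-exchange = solve 3 (λ a b c → a :+ (b :+ c) := b :+ (a :+ c)) refl

  sign-+ : ∀ m n → sign (m ℕ.+ n) ≈ sign m * sign n
  sign-+ zero    n = sym (*-identityˡ _)
  sign-+ (suc m) n = trans (-‿cong (sign-+ m n)) (-‿distribˡ-* _ _)

  sign-*-self : ∀ n → sign n * sign n ≈ 1#
  sign-*-self zero    = *-identityˡ 1#
  sign-*-self (suc n) = trans (-x*-x≈x*x (sign n)) (sign-*-self n)
    where
    -x*-x≈x*x : ∀ x → - x * - x ≈ x * x
    -x*-x≈x*x = solve 1 (λ x → (:- x) :* (:- x) := x :* x) refl

  minor : ∀ {n} → Matrix (suc n) → Fin (suc n) → Matrix n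
  minor M j i k = M (suc i) (punchIn j k)

  expansionTerm : ∀ {n} → Matrix (suc n) → Fin (suc n) → Carrier
  expansionTerm {n} M j = sign (toℕ j) * (M zero j * det n (minor M j))

  det-cong : ∀ n {M N : Matrix n} → (∀ i j → M i j ≈ N i j) → det n M ≈ det n N
  det-cong zero    M≈N = refl
  det-cong (suc n) M≈N = sumFin-cong (suc n) λ j →
    *-congˡ {sign (toℕ j)} (*-cong (M≈N zero j) (det-cong n λ i k → M≈N (suc i) (punchIn j k)))

  det-scale : ∀ n s (M : Matrix n) → det n (λ i j → s * M i j) ≈ s ^ n * det n M
  det-scale zero    s M = sym (*-identityˡ 1#)
  det-scale (suc n) s M = begin
    det (suc n) (λ i j → s * M i j)
      ≈⟨ sumFin-cong (suc n) (λ j →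
           trans (*-congˡ (*-congˡ (det-scale n s (minor M j))))
                 (rearrange (sign (toℕ j)) s (M zero j) (s ^ n) (det n (minor M j)))) ⟩
    sumFin (suc n) (λ j → s ^ suc n * expansionTerm M j)
      ≈⟨ *-distribˡ-sumFin (suc n) (s ^ suc n) (expansionTerm M) ⟨
    s ^ suc n * det (suc n) M ∎
    where
    rearrange : ∀ σ s m p d → σ * ((s * m) * (p * d)) ≈ (s * p) * (σ * (m * d))
    rearrange = solve 5 (λ σ s m p d → σ :* ((s :* m) :* (p :* d)) := (s :* p) :* (σ :* (m :* d))) refl

  sign-toℕ-pinch : ∀ {n} (r : Fin (suc n)) (j : Fin n) →
    sign (suc (toℕ j)) * sign (toℕ (pinch j r)) ≈ sign (toℕ r) * sign (toℕ (punchIn r j))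
  sign-toℕ-pinch r j = begin
    sign (suc (toℕ j)) * sign (toℕ (pinch j r))    ≈⟨ sign-+ (suc (toℕ j)) _ ⟨
    sign (suc (toℕ j) ℕ.+ toℕ (pinch j r))        ≡⟨ ≡.cong sign (toℕ-pinch-+ r j) ⟩
    sign (toℕ r ℕ.+ toℕ (punchIn r j))            ≈⟨ sign-+ (toℕ r) _ ⟩
    sign (toℕ r) * sign (toℕ (punchIn r j))       ∎

  toFront : ∀ {n} → Fin (suc n) → Fin (suc n) → Fin (suc n)
  toFront r zero    = r
  toFront r (suc k) = punchIn r k

  det-toFront : ∀ n (M : Matrix (suc n)) r →
                det (suc n) (λ i k → M i (toFront r k)) ≈ sign (toℕ r) * det (suc n) M
  det-toFront zero    M zero = sym (*-identityˡ _)
  det-toFront (suc m) M r    = begin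
    expansionTerm Mr zero + sumFin (suc m) (expansionTerm Mr ∘ suc)
      ≈⟨ +-cong front (sumFin-cong (suc m) rest) ⟩
    σ * expansionTerm M r + sumFin (suc m) (λ j → σ * expansionTerm M (punchIn r j))
      ≈⟨ +-congˡ (*-distribˡ-sumFin (suc m) σ (expansionTerm M ∘ punchIn r)) ⟨
    σ * expansionTerm M r + σ * sumFin (suc m) (expansionTerm M ∘ punchIn r)
      ≈⟨ distribˡ σ _ _ ⟨
    σ * (expansionTerm M r + sumFin (suc m) (expansionTerm M ∘ punchIn r))
      ≈⟨ *-congˡ (sumFin-punchIn (suc m) (expansionTerm M) r) ⟨
    σ * det (suc (suc m)) M ∎
    where
    σ = sign (toℕ r)
    Mr : Matrix (suc (suc m))
    Mr i k = M i (toFront r k)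
    front : expansionTerm Mr zero ≈ σ * expansionTerm M r
    front = trans (*-congʳ (sym (sign-*-self (toℕ r)))) (*-assoc _ _ _)
    rest : ∀ j → expansionTerm Mr (suc j) ≈ σ * expansionTerm M (punchIn r j)
    rest j = begin
      sign (suc (toℕ j)) * (M zero J * det (suc m) (minor Mr (suc j)))
        ≈⟨ *-congˡ (*-congˡ (det-cong (suc m) (λ i k → reflexive (minor-Mr i k)))) ⟩
      sign (suc (toℕ j)) * (M zero J * det (suc m) (λ i k → minor M J i (toFront (pinch j r) k)))
        ≈⟨ *-congˡ (*-congˡ (det-toFront m (minor M J) (pinch j r))) ⟩
      sign (suc (toℕ j)) * (M zero J * (sign (toℕ (pinch j r)) * det (suc m) (minor M J)))
        ≈⟨ rearrange _ _ _ _ ⟩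
      (sign (suc (toℕ j)) * sign (toℕ (pinch j r))) * (M zero J * det (suc m) (minor M J))
        ≈⟨ *-congʳ (sign-toℕ-pinch r j) ⟩
      (σ * sign (toℕ J)) * (M zero J * det (suc m) (minor M J))
        ≈⟨ *-assoc _ _ _ ⟩
      σ * expansionTerm M J ∎
      where
      J = punchIn r j
      minor-Mr : ∀ i k → minor Mr (suc j) i k ≡.≡ minor M J i (toFront (pinch j r) k)
      minor-Mr i zero    = ≡.cong (M (suc i)) (≡.sym (punchIn-punchIn-pinch r j))
      minor-Mr i (suc k) = ≡.cong (M (suc i)) (≡.sym (punchIn-punchIn-punchIn-pinch r j k))
      rearrange : ∀ x a y d → x * (a * (y * d)) ≈ (x * y) * (a * d)
      rearrange = solve 4 (λ x a y d → x :* (a :* (y :* d)) := (x :* y) :* (a :* d)) refl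

  det-equalColumns₀ : ∀ n (M : Matrix (suc n)) q → (∀ i → M i zero ≈ M i (suc q)) → det (suc n) M ≈ 0#
  det-equalColumns₀ (suc m) M q col≈ = begin
    T zero + sumFin (suc m) (T ∘ suc)
      ≈⟨ +-congˡ (sumFin-punchIn m (T ∘ suc) q) ⟩
    T zero + (T (suc q) + sumFin m (T ∘ suc ∘ punchIn q))
      ≈⟨ +-congˡ (+-cong cancel (sumFin-zero m vanish)) ⟩
    T zero + (- T zero + 0#)
      ≈⟨ x+[-x+0]≈0 (T zero) ⟩
    0# ∎
    where
    T = expansionTerm M
    x+[-x+0]≈0 : ∀ x → x + (- x + 0#) ≈ 0#
    x+[-x+0]≈0 = solve 1 (λ x → x :+ (:- x :+ con (+ 0)) := con (+ 0)) refl
    D₀ = det (suc m) (minor M zero)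
    cancel : T (suc q) ≈ - T zero
    cancel = begin
      - sign (toℕ q) * (M zero (suc q) * det (suc m) (minor M (suc q)))
        ≈⟨ *-congˡ (*-cong (sym (col≈ zero)) (det-cong (suc m) minor≈)) ⟩
      - sign (toℕ q) * (M zero zero * det (suc m) (λ i k → minor M zero i (toFront q k)))
        ≈⟨ *-congˡ (*-congˡ (det-toFront m (minor M zero) q)) ⟩
      - sign (toℕ q) * (M zero zero * (sign (toℕ q) * D₀))
        ≈⟨ rearrange (sign (toℕ q)) _ _ ⟩
      - ((sign (toℕ q) * sign (toℕ q)) * (M zero zero * D₀))
        ≈⟨ -‿cong (*-cong (sign-*-self (toℕ q)) refl) ⟩
      - (1# * (M zero zero * D₀)) ∎
      where
      minor≈ : ∀ i k → minor M (suc q) i k ≈ minor M zero i (toFront q k)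
      minor≈ i zero    = col≈ (suc i)
      minor≈ i (suc k) = refl
      rearrange : ∀ s a d → - s * (a * (s * d)) ≈ - ((s * s) * (a * d))
      rearrange = solve 3 (λ s a d → (:- s) :* (a :* (s :* d)) := :- ((s :* s) :* (a :* d))) refl
    vanish : ∀ k → T (suc (punchIn q k)) ≈ 0#
    vanish k = trans (*-congˡ (*-congˡ (det-equalColumns₀ m (minor M (suc (punchIn q k))) (pinch k q) λ i →
                 trans (col≈ (suc i)) (reflexive (≡.cong (M (suc i) ∘ suc) (≡.sym (punchIn-punchIn-pinch q k)))))))
               (trans (*-congˡ (zeroʳ _)) (zeroʳ _))

  det-equalColumns : ∀ n (M : Matrix (suc n)) q p →
                     (∀ i → M i q ≈ M i (punchIn q p)) → det (suc n) M ≈ 0#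
  det-equalColumns n M q p col≈ = begin
    det (suc n) M             ≈⟨ *-identityˡ _ ⟨
    1# * det (suc n) M        ≈⟨ *-congʳ (sign-*-self (toℕ q)) ⟨
    (σ * σ) * det (suc n) M   ≈⟨ *-assoc _ _ _ ⟩
    σ * (σ * det (suc n) M)   ≈⟨ *-congˡ (det-toFront n M q) ⟨
    σ * det (suc n) Mq        ≈⟨ *-congˡ (det-equalColumns₀ n Mq p col≈) ⟩
    σ * 0#                    ≈⟨ zeroʳ σ ⟩
    0#                        ∎
    where
    σ = sign (toℕ q)
    Mq : Matrix (suc n)
    Mq i k = M i (toFront q k)

  infix 8 _ᵀ
  _ᵀ : ∀ {n} → Matrix n → Matrix n
  (M ᵀ) i j = M j i

  Transposable : ℕ → Set (κ Level.⊔ ℓ)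
  Transposable n = ∀ (M : Matrix n) → det n (M ᵀ) ≈ det n M

  -- Expand along the first row, then every minor along its first column:
  -- both determinants become the same double sum.
  det-ᵀ-step : ∀ m → Transposable (suc m) → Transposable m → Transposable (suc (suc m))
  det-ᵀ-step m det-ᵀ₁ det-ᵀ₀ M = +-cong (*-congˡ (*-congˡ (det-ᵀ₁ (minor M zero)))) (begin
    sumFin (suc m) (λ i → expansionTerm (M ᵀ) (suc i))  ≈⟨ sumFin-cong (suc m) byRow ⟩
    sumFin (suc m) (λ i → sumFin (suc m) (λ j → T j i)) ≈⟨ sumFin-comm (suc m) (suc m) (λ i j → T j i) ⟩
    sumFin (suc m) (λ j → sumFin (suc m) (λ i → T j i)) ≈⟨ sumFin-cong (suc m) byColumn ⟨
    sumFin (suc m) (λ j → expansionTerm M (suc j))     ∎)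
    where
    *-distribˡ-sumFin₂ : ∀ n x y (f : Fin n → Carrier) → x * (y * sumFin n f) ≈ sumFin n (λ k → x * (y * f k))
    *-distribˡ-sumFin₂ n x y f = trans (*-congˡ (*-distribˡ-sumFin n y f)) (*-distribˡ-sumFin n x _)
    D : Fin (suc m) → Fin (suc m) → Carrier
    D i j = det m (λ r c → M (suc (punchIn i r)) (suc (punchIn j c)))
    T : Fin (suc m) → Fin (suc m) → Carrier
    T j i = sign (suc (toℕ j)) * (M zero (suc j) * (sign (toℕ i) * (M (suc i) zero * D i j)))
    byColumn : ∀ j → expansionTerm M (suc j) ≈ sumFin (suc m) (T j)
    byColumn j = begin
      sign (suc (toℕ j)) * (M zero (suc j) * det (suc m) (minor M (suc j)))
        ≈⟨ *-congˡ (*-congˡ (det-ᵀ₁ (minor M (suc j)))) ⟨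
      sign (suc (toℕ j)) * (M zero (suc j) * det (suc m) (minor M (suc j) ᵀ))
        ≈⟨ *-congˡ (*-congˡ (sumFin-cong (suc m) λ i → *-congˡ {sign (toℕ i)} (*-congˡ {M (suc i) zero}
             (det-ᵀ₀ (λ r c → M (suc (punchIn i r)) (suc (punchIn j c))))))) ⟩
      sign (suc (toℕ j)) * (M zero (suc j) * sumFin (suc m) (λ i → sign (toℕ i) * (M (suc i) zero * D i j)))
        ≈⟨ *-distribˡ-sumFin₂ (suc m) _ _ (λ i → sign (toℕ i) * (M (suc i) zero * D i j)) ⟩
      sumFin (suc m) (T j) ∎
    byRow : ∀ i → expansionTerm (M ᵀ) (suc i) ≈ sumFin (suc m) (λ j → T j i)
    byRow i = begin
      sign (suc (toℕ i)) * (M (suc i) zero * det (suc m) (minor (M ᵀ) (suc i)))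
        ≈⟨ *-congˡ (*-congˡ (det-ᵀ₁ (minor (M ᵀ) (suc i)))) ⟨
      sign (suc (toℕ i)) * (M (suc i) zero * det (suc m) (minor (M ᵀ) (suc i) ᵀ))
        ≈⟨ *-distribˡ-sumFin₂ (suc m) _ _ (expansionTerm (minor (M ᵀ) (suc i) ᵀ)) ⟩
      sumFin (suc m) (λ j → sign (suc (toℕ i)) * (M (suc i) zero * (sign (toℕ j) * (M zero (suc j) * D i j))))
        ≈⟨ sumFin-cong (suc m) (λ j →
             rearrange (sign (toℕ i)) (M (suc i) zero) (sign (toℕ j)) (M zero (suc j)) (D i j)) ⟩
      sumFin (suc m) (λ j → T j i) ∎
      where
      rearrange : ∀ si b sj a d → - si * (b * (sj * (a * d))) ≈ - sj * (a * (si * (b * d)))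
      rearrange = solve 5 (λ si b sj a d → (:- si) :* (b :* (sj :* (a :* d))) := (:- sj) :* (a :* (si :* (b :* d)))) refl

  det-ᵀ : ∀ n → Transposable n
  det-ᵀ zero          M = refl
  det-ᵀ (suc zero)    M = refl
  det-ᵀ (suc (suc m))   = det-ᵀ-step m (det-ᵀ (suc m)) (det-ᵀ m)

  replaceRow : ∀ {n} → Matrix n → Fin n → (Fin n → Carrier) → Matrix n
  replaceRow M t v = updateAt M t (const v)

  replaceRow-cong : ∀ {n} (M : Matrix n) t {v w : Fin n → Carrier} → (∀ j → v j ≈ w j) →
                    ∀ i j → replaceRow M t v i j ≈ replaceRow M t w i j
  replaceRow-cong M t {v} {w} v≈w i j with i Fin.≟ t
  ... | yes ≡.refl = begin
    replaceRow M i v i j ≡⟨ ≡.cong (λ row → row j) (updateAt-updates i M) ⟩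
    v j                  ≈⟨ v≈w j ⟩
    w j                  ≡⟨ ≡.cong (λ row → row j) (updateAt-updates i M) ⟨
    replaceRow M i w i j ∎
  ... | no i≢t = reflexive (≡.cong (λ row → row j)
                   (≡.trans (updateAt-minimal i t M i≢t) (≡.sym (updateAt-minimal i t M i≢t))))

  minor-replaceRow : ∀ {m} (M : Matrix (suc (suc m))) t w j i k →
    minor (replaceRow M (suc t) w) j i k ≡.≡ replaceRow (minor M j) t (w ∘ punchIn j) i k
  minor-replaceRow M t w j i k =
    ≡.cong (λ row → row k) (map-updateAt {f = _∘ punchIn j} (λ _ → ≡.refl) (M ∘ suc) t i)

  det-replaceRow-linear : ∀ n (M : Matrix n) t s r (u v : Fin n → Carrier) →
    det n (replaceRow M t (λ j → s * u j + r * v j)) ≈ s * det n (replaceRow M t u) + r * det n (replaceRow M t v)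
  det-replaceRow-linear (suc n) M zero s r u v = begin
    sumFin (suc n) (λ j → sign (toℕ j) * ((s * u j + r * v j) * det n (minor M j)))
      ≈⟨ sumFin-cong (suc n) (λ j → distribute (sign (toℕ j)) s (u j) r (v j) (det n (minor M j))) ⟩
    sumFin (suc n) (λ j → s * Tu j + r * Tv j)
      ≈⟨ sumFin-+ (suc n) (λ j → s * Tu j) (λ j → r * Tv j) ⟩
    sumFin (suc n) (λ j → s * Tu j) + sumFin (suc n) (λ j → r * Tv j)
      ≈⟨ +-cong (*-distribˡ-sumFin (suc n) s Tu) (*-distribˡ-sumFin (suc n) r Tv) ⟨
    s * det (suc n) (replaceRow M zero u) + r * det (suc n) (replaceRow M zero v) ∎
    where
    Tu = expansionTerm (replaceRow M zero u)
    Tv = expansionTerm (replaceRow M zero v)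
    distribute : ∀ σ s u r v d → σ * ((s * u + r * v) * d) ≈ s * (σ * (u * d)) + r * (σ * (v * d))
    distribute = solve 6 (λ σ s u r v d →
      σ :* ((s :* u :+ r :* v) :* d) := s :* (σ :* (u :* d)) :+ r :* (σ :* (v :* d))) refl
  det-replaceRow-linear (suc (suc m)) M (suc t) s r u v = begin
    sumFin (suc (suc m)) (expansionTerm (replaceRow M (suc t) w))
      ≈⟨ sumFin-cong (suc (suc m)) termwise ⟩
    sumFin (suc (suc m)) (λ j → s * Tu j + r * Tv j)
      ≈⟨ sumFin-+ (suc (suc m)) (λ j → s * Tu j) (λ j → r * Tv j) ⟩
    sumFin (suc (suc m)) (λ j → s * Tu j) + sumFin (suc (suc m)) (λ j → r * Tv j)
      ≈⟨ +-cong (*-distribˡ-sumFin (suc (suc m)) s Tu) (*-distribˡ-sumFin (suc (suc m)) r Tv) ⟨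
    s * det (suc (suc m)) (replaceRow M (suc t) u) + r * det (suc (suc m)) (replaceRow M (suc t) v) ∎
    where
    w = λ j → s * u j + r * v j
    Tu = expansionTerm (replaceRow M (suc t) u)
    Tv = expansionTerm (replaceRow M (suc t) v)
    detMinor : ∀ x j → det (suc m) (minor (replaceRow M (suc t) x) j) ≈
                       det (suc m) (replaceRow (minor M j) t (x ∘ punchIn j))
    detMinor x j = det-cong (suc m) (λ i k → reflexive (minor-replaceRow M t x j i k))
    distribute : ∀ σ a s A r B → σ * (a * (s * A + r * B)) ≈ s * (σ * (a * A)) + r * (σ * (a * B))
    distribute = solve 6 (λ σ a s A r B →
      σ :* (a :* (s :* A :+ r :* B)) := s :* (σ :* (a :* A)) :+ r :* (σ :* (a :* B))) refl
    termwise : ∀ j → expansionTerm (replaceRow M (suc t) w) j ≈ s * Tu j + r * Tv j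
    termwise j = begin
      sign (toℕ j) * (M zero j * det (suc m) (minor (replaceRow M (suc t) w) j))
        ≈⟨ *-congˡ (*-congˡ (trans (detMinor w j)
             (det-replaceRow-linear (suc m) (minor M j) t s r (u ∘ punchIn j) (v ∘ punchIn j)))) ⟩
      sign (toℕ j) * (M zero j * (s * det (suc m) (replaceRow (minor M j) t (u ∘ punchIn j))
                                  + r * det (suc m) (replaceRow (minor M j) t (v ∘ punchIn j))))
        ≈⟨ distribute _ _ _ _ _ _ ⟩
      s * (sign (toℕ j) * (M zero j * det (suc m) (replaceRow (minor M j) t (u ∘ punchIn j))))
        + r * (sign (toℕ j) * (M zero j * det (suc m) (replaceRow (minor M j) t (v ∘ punchIn j))))
        ≈⟨ +-cong (*-congˡ (*-congˡ (*-congˡ (detMinor u j)))) (*-congˡ (*-congˡ (*-congˡ (detMinor v j)))) ⟨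
      s * Tu j + r * Tv j ∎

  det-replaceRow-+ : ∀ n (M : Matrix n) t (u v : Fin n → Carrier) →
    det n (replaceRow M t (λ j → u j + v j)) ≈ det n (replaceRow M t u) + det n (replaceRow M t v)
  det-replaceRow-+ n M t u v = begin
    det n (replaceRow M t (λ j → u j + v j))
      ≈⟨ det-cong n (replaceRow-cong M t (λ j → +-cong (*-identityˡ (u j)) (*-identityˡ (v j)))) ⟨
    det n (replaceRow M t (λ j → 1# * u j + 1# * v j))
      ≈⟨ det-replaceRow-linear n M t 1# 1# u v ⟩
    1# * det n (replaceRow M t u) + 1# * det n (replaceRow M t v)
      ≈⟨ +-cong (*-identityˡ _) (*-identityˡ _) ⟩
    det n (replaceRow M t u) + det n (replaceRow M t v) ∎

  det-replaceRow-* : ∀ n (M : Matrix n) t s (u : Fin n → Carrier) →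
    det n (replaceRow M t (λ j → s * u j)) ≈ s * det n (replaceRow M t u)
  det-replaceRow-* n M t s u = begin
    det n (replaceRow M t (λ j → s * u j))
      ≈⟨ det-cong n (replaceRow-cong M t (λ j → x≈x+0*y (s * u j) (u j))) ⟩
    det n (replaceRow M t (λ j → s * u j + 0# * u j))
      ≈⟨ det-replaceRow-linear n M t s 0# u u ⟩
    s * det n (replaceRow M t u) + 0# * det n (replaceRow M t u)
      ≈⟨ x≈x+0*y _ _ ⟨
    s * det n (replaceRow M t u) ∎
    where
    x≈x+0*y : ∀ x y → x ≈ x + 0# * y
    x≈x+0*y = solve 2 (λ x y → x := x :+ con (+ 0) :* y) refl

  det-replaceRow-sumFin : ∀ n (M : Matrix n) t m (g : Fin m → Fin n → Carrier) →
    det n (replaceRow M t (λ j → sumFin m (λ k → g k j))) ≈ sumFin m (λ k → det n (replaceRow M t (g k)))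
  det-replaceRow-sumFin n M t zero g = begin
    det n (replaceRow M t (λ _ → 0#))        ≈⟨ det-cong n (replaceRow-cong M t (λ _ → zeroˡ 0#)) ⟨
    det n (replaceRow M t (λ _ → 0# * 0#))   ≈⟨ det-replaceRow-* n M t 0# (λ _ → 0#) ⟩
    0# * det n (replaceRow M t (λ _ → 0#))   ≈⟨ zeroˡ _ ⟩
    0#                                       ∎
  det-replaceRow-sumFin n M t (suc m) g =
    trans (det-replaceRow-+ n M t (g zero) (λ j → sumFin m (λ k → g (suc k) j)))
          (+-congˡ (det-replaceRow-sumFin n M t m (g ∘ suc)))

  det-equalRows : ∀ n (M : Matrix (suc n)) t p → (∀ j → M t j ≈ M (punchIn t p) j) → det (suc n) M ≈ 0#
  det-equalRows n M t p row≈ = trans (sym (det-ᵀ (suc n) M)) (det-equalColumns n (M ᵀ) t p row≈)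

  det-addMultiplesOfOtherRows : ∀ n (M : Matrix (suc n)) t (c : Fin n → Carrier) →
    det (suc n) (replaceRow M t (λ j → M t j + sumFin n (λ k → c k * M (punchIn t k) j))) ≈ det (suc n) M
  det-addMultiplesOfOtherRows n M t c = begin
    det (suc n) (replaceRow M t (λ j → M t j + sumFin n (λ k → c k * M (punchIn t k) j)))
      ≈⟨ det-replaceRow-+ (suc n) M t (M t) _ ⟩
    det (suc n) (replaceRow M t (M t)) + det (suc n) (replaceRow M t (λ j → sumFin n (λ k → c k * M (punchIn t k) j)))
      ≈⟨ +-cong (det-cong (suc n) λ i j → reflexive (≡.cong (λ row → row j) (updateAt-id-local t M ≡.refl i)))
                (det-replaceRow-sumFin (suc n) M t n (λ k j → c k * M (punchIn t k) j)) ⟩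
    det (suc n) M + sumFin n (λ k → det (suc n) (replaceRow M t (λ j → c k * M (punchIn t k) j)))
      ≈⟨ +-congˡ (sumFin-zero n λ k → trans (det-replaceRow-* (suc n) M t (c k) (M (punchIn t k)))
                                          (trans (*-congˡ (repeatedRow k)) (zeroʳ _))) ⟩
    det (suc n) M + 0#
      ≈⟨ +-identityʳ _ ⟩
    det (suc n) M ∎
    where
    repeatedRow : ∀ k → det (suc n) (replaceRow M t (M (punchIn t k))) ≈ 0#
    repeatedRow k = det-equalRows n (replaceRow M t (M (punchIn t k))) t k λ j →
      reflexive (≡.cong (λ row → row j) (≡.trans (updateAt-updates t M)
        (≡.sym (updateAt-minimal (punchIn t k) t M (Fin.punchInᵢ≢i t k)))))

  infixl 7 _·_
  _·_ : ∀ {n} → Matrix n → Matrix n → Matrix n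
  (A · B) i j = sumFin _ (λ k → A i k * B k j)

  IsLowerUnitriangular : ∀ {n} → Matrix n → Set ℓ
  IsLowerUnitriangular L = (∀ i → L i i ≈ 1#) × (∀ i k → toℕ i ℕ.< toℕ k → L i k ≈ 0#)

  IsUpperUnitriangular : ∀ {n} → Matrix n → Set ℓ
  IsUpperUnitriangular U = IsLowerUnitriangular (U ᵀ)

  -- mixed t has the rows of M above row t and those of L · M from row t on; passing from
  -- mixed t to mixed (1 + t) subtracts from row t multiples of the rows above it.
  module LowerUnitriangularProduct {n} (L M : Matrix (suc n)) (L-lower : IsLowerUnitriangular L) where
    private
      rowOf : ∀ {u v : Fin (suc n) → Carrier} j → u ≡.≡ v → u j ≡.≡ v j
      rowOf j = ≡.cong (λ row → row j)

    mixed : ℕ → Matrix (suc n)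
    mixed t i = if does (toℕ i ℕ.<? t) then M i else (L · M) i

    mixed-below : ∀ {t i} → toℕ i ℕ.< t → mixed t i ≡.≡ M i
    mixed-below {t} {i} i<t = ≡.cong (λ b → if b then M i else (L · M) i) (dec-true (toℕ i ℕ.<? t) i<t)

    mixed-notBelow : ∀ {t i} → ¬ toℕ i ℕ.< t → mixed t i ≡.≡ (L · M) i
    mixed-notBelow {t} {i} i≮t = ≡.cong (λ b → if b then M i else (L · M) i) (dec-false (toℕ i ℕ.<? t) i≮t)

    mixed-suc : ∀ {t i} → toℕ i ≢ t → mixed t i ≡.≡ mixed (suc t) i
    mixed-suc {t} {i} i≢t with toℕ i ℕ.<? t
    ... | yes i<t = ≡.trans (mixed-below i<t) (≡.sym (mixed-below (ℕ.m<n⇒m<1+n i<t)))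
    ... | no  i≮t = ≡.trans (mixed-notBelow i≮t)
                            (≡.sym (mixed-notBelow (λ i<1+t → i≮t (ℕ.≤∧≢⇒< (ℕ.s≤s⁻¹ i<1+t) i≢t))))

    row-expansion : ∀ t (r : Fin (suc n)) → toℕ r ≡.≡ t → ∀ j →
      (L · M) r j ≈ mixed (suc t) r j + sumFin n (λ k → L r (punchIn r k) * mixed (suc t) (punchIn r k) j)
    row-expansion t r r≡t j = begin
      sumFin (suc n) (λ k → L r k * M k j)
        ≈⟨ sumFin-punchIn n (λ k → L r k * M k j) r ⟩
      L r r * M r j + sumFin n (λ k → L r (punchIn r k) * M (punchIn r k) j)
        ≈⟨ +-cong (trans (*-congʳ (proj₁ L-lower r)) (*-identityˡ _)) (sumFin-cong n term) ⟩
      M r j + sumFin n (λ k → L r (punchIn r k) * mixed (suc t) (punchIn r k) j)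
        ≡⟨ ≡.cong (_+ sumFin n (λ k → L r (punchIn r k) * mixed (suc t) (punchIn r k) j))
                  (rowOf j (≡.sym (mixed-below (≡.subst (toℕ r ℕ.<_) (≡.cong suc r≡t) ℕ.≤-refl)))) ⟩
      mixed (suc t) r j + sumFin n (λ k → L r (punchIn r k) * mixed (suc t) (punchIn r k) j) ∎
      where
      term : ∀ k → L r (punchIn r k) * M (punchIn r k) j ≈ L r (punchIn r k) * mixed (suc t) (punchIn r k) j
      term k with toℕ (punchIn r k) ℕ.<? suc t
      ... | yes below = *-congˡ (reflexive (rowOf j (≡.sym (mixed-below below))))
      ... | no  above = trans (*-congʳ L≈0) (trans (zeroˡ _) (sym (trans (*-congʳ L≈0) (zeroˡ _))))
        where
        L≈0 : L r (punchIn r k) ≈ 0#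
        L≈0 = proj₂ L-lower r (punchIn r k) (≡.subst (ℕ._< toℕ (punchIn r k)) (≡.sym r≡t) (ℕ.≮⇒≥ above))

    det-mixed-suc : ∀ t (r : Fin (suc n)) → toℕ r ≡.≡ t → det (suc n) (mixed t) ≈ det (suc n) (mixed (suc t))
    det-mixed-suc t r r≡t = begin
      det (suc n) (mixed t)
        ≈⟨ det-cong (suc n) rowwise ⟩
      det (suc n) (replaceRow M′ r (λ j → M′ r j + sumFin n (λ k → L r (punchIn r k) * M′ (punchIn r k) j)))
        ≈⟨ det-addMultiplesOfOtherRows n M′ r (λ k → L r (punchIn r k)) ⟩
      det (suc n) M′ ∎
      where
      M′ = mixed (suc t)
      rowwise : ∀ i j → mixed t i j ≈
                replaceRow M′ r (λ j → M′ r j + sumFin n (λ k → L r (punchIn r k) * M′ (punchIn r k) j)) i j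
      rowwise i j with i Fin.≟ r
      ... | yes ≡.refl = begin
        mixed t i j  ≡⟨ rowOf j (mixed-notBelow (ℕ.≤⇒≯ (ℕ.≤-reflexive (≡.sym r≡t)))) ⟩
        (L · M) i j  ≈⟨ row-expansion t i r≡t j ⟩
        _            ≡⟨ rowOf j (updateAt-updates i M′) ⟨
        _            ∎
      ... | no i≢r = reflexive (rowOf j (≡.trans
              (mixed-suc (λ i≡t → i≢r (Fin.toℕ-injective (≡.trans i≡t (≡.sym r≡t)))))
              (≡.sym (updateAt-minimal i r M′ i≢r))))

    det-mixed : ∀ t → t ℕ.≤ suc n → det (suc n) (mixed 0) ≈ det (suc n) (mixed t)
    det-mixed zero    _    = refl
    det-mixed (suc t) t<1+n =
      trans (det-mixed t (ℕ.≤-trans (ℕ.n≤1+n t) t<1+n)) (det-mixed-suc t (fromℕ< t<1+n) (Fin.toℕ-fromℕ< t<1+n))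

  det-lowerUnitriangular-· : ∀ n (L M : Matrix n) → IsLowerUnitriangular L → det n (L · M) ≈ det n M
  det-lowerUnitriangular-· zero    L M _       = refl
  det-lowerUnitriangular-· (suc n) L M L-lower = begin
    det (suc n) (L · M)          ≈⟨ det-cong (suc n) (λ i j → reflexive (rowOf j (mixed-notBelow {0} {i} (λ ())))) ⟨
    det (suc n) (mixed 0)        ≈⟨ det-mixed (suc n) ℕ.≤-refl ⟩
    det (suc n) (mixed (suc n))  ≈⟨ det-cong (suc n) (λ i j → reflexive (rowOf j (mixed-below (Fin.toℕ<n i)))) ⟩
    det (suc n) M                ∎
    where
    open LowerUnitriangularProduct L M L-lower
    rowOf : ∀ {u v : Fin (suc n) → Carrier} j → u ≡.≡ v → u j ≡.≡ v j
    rowOf j = ≡.cong (λ row → row j)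

  det-·-upperUnitriangular : ∀ n (M U : Matrix n) → IsUpperUnitriangular U → det n (M · U) ≈ det n M
  det-·-upperUnitriangular n M U U-upper = begin
    det n (M · U)        ≈⟨ det-ᵀ n (M · U) ⟨
    det n ((M · U) ᵀ)    ≈⟨ det-cong n (λ i j → sumFin-cong n (λ k → *-comm _ _)) ⟩
    det n (U ᵀ · M ᵀ)    ≈⟨ det-lowerUnitriangular-· n (U ᵀ) (M ᵀ) U-upper ⟩
    det n (M ᵀ)          ≈⟨ det-ᵀ n M ⟩
    det n M              ∎

  det-firstColumnZero : ∀ n (M : Matrix (suc n)) → (∀ i → M (suc i) zero ≈ 0#) →
                        det (suc n) M ≈ M zero zero * det n (λ i j → M (suc i) (suc j))
  det-firstColumnZero n M column≈0 = begin
    det (suc n) M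
      ≈⟨ det-ᵀ (suc n) M ⟨
    1# * (M zero zero * det n (minor (M ᵀ) zero)) + sumFin n (expansionTerm (M ᵀ) ∘ suc)
      ≈⟨ +-cong (*-identityˡ _) (sumFin-zero n vanish) ⟩
    M zero zero * det n (minor (M ᵀ) zero) + 0#
      ≈⟨ +-identityʳ _ ⟩
    M zero zero * det n (minor (M ᵀ) zero)
      ≈⟨ *-congˡ (det-ᵀ n (λ i j → M (suc i) (suc j))) ⟩
    M zero zero * det n (λ i j → M (suc i) (suc j)) ∎
    where
    vanish : ∀ j → expansionTerm (M ᵀ) (suc j) ≈ 0#
    vanish j = trans (*-congˡ (trans (*-congʳ (column≈0 j)) (zeroˡ _))) (zeroʳ _)

module PowerSeries {κ ℓ : Level} (F : Field κ ℓ) where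
  open Field F hiding (zero)
  open import Algebra.Properties.Ring ring using (-0#≈0#; x∙y⁻¹≈ε⇒x≈y)
  open FieldTheory F hiding (_≈ₛ_)
  open IntegerCoefficients commutativeRing
  open import Relation.Binary.Reasoning.Setoid setoid

  shift : Series → Series
  shift A k = A (suc k)

  cst : Carrier → Series
  cst c zero    = c
  cst c (suc _) = 0#

  X : Series
  X zero          = 0#
  X (suc zero)    = 1#
  X (suc (suc _)) = 0#

  convolve-cong : ∀ n {A A′ B B′ : Series} → (∀ k → A k ≈ A′ k) → (∀ k → B k ≈ B′ k) →
                  convolve n A B ≈ convolve n A′ B′
  convolve-cong zero    A≈A′ B≈B′ = *-cong (A≈A′ 0) (B≈B′ 0)
  convolve-cong (suc n) A≈A′ B≈B′ =
    +-cong (*-cong (A≈A′ 0) (B≈B′ (suc n))) (convolve-cong n (A≈A′ ∘ suc) B≈B′)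

  convolve-*ˡ : ∀ n s (A B : Series) → convolve n (λ k → s * A k) B ≈ s * convolve n A B
  convolve-*ˡ zero    s A B = *-assoc _ _ _
  convolve-*ˡ (suc n) s A B =
    trans (+-cong (*-assoc _ _ _) (convolve-*ˡ n s (shift A) B)) (sym (distribˡ _ _ _))

  convolve-zeroˡ : ∀ n (A B : Series) → (∀ k → A k ≈ 0#) → convolve n A B ≈ 0#
  convolve-zeroˡ zero    A B A≈0 = trans (*-congʳ (A≈0 0)) (zeroˡ _)
  convolve-zeroˡ (suc n) A B A≈0 = trans (+-cong (trans (*-congʳ (A≈0 0)) (zeroˡ _))
                                               (convolve-zeroˡ n (shift A) B (λ k → A≈0 (suc k))))
                                        (+-identityʳ 0#)

  convolve-cstˡ : ∀ n c (B : Series) → convolve n (cst c) B ≈ c * B n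
  convolve-cstˡ zero    c B = refl
  convolve-cstˡ (suc n) c B = trans (+-congˡ (convolve-zeroˡ n (shift (cst c)) B (λ _ → refl))) (+-identityʳ _)

  convolve-Xˡ : ∀ n (B : Series) → convolve (suc n) X B ≈ B n
  convolve-Xˡ n B = begin
    0# * B (suc n) + convolve n (shift X) B  ≈⟨ +-cong (zeroˡ _) (convolve-cong n shiftX≈1 (λ _ → refl)) ⟩
    0# + convolve n (cst 1#) B               ≈⟨ +-identityˡ _ ⟩
    convolve n (cst 1#) B                    ≈⟨ convolve-cstˡ n 1# B ⟩
    1# * B n                                 ≈⟨ *-identityˡ _ ⟩
    B n                                      ∎
    where
    shiftX≈1 : ∀ k → shift X k ≈ cst 1# k
    shiftX≈1 zero    = refl
    shiftX≈1 (suc k) = refl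

  convolve-snoc : ∀ n (A B : Series) → convolve (suc n) A B ≈ convolve n A (shift B) + A (suc n) * B 0
  convolve-snoc zero    A B = refl
  convolve-snoc (suc n) A B = trans (+-congˡ (convolve-snoc n (shift A) B)) (sym (+-assoc _ _ _))

  convolve-comm : ∀ n (A B : Series) → convolve n A B ≈ convolve n B A
  convolve-comm zero    A B = *-comm _ _
  convolve-comm (suc n) A B = begin
    A 0 * B (suc n) + convolve n (shift A) B  ≈⟨ +-cong (*-comm _ _) (convolve-comm n (shift A) B) ⟩
    B (suc n) * A 0 + convolve n B (shift A)  ≈⟨ +-comm _ _ ⟩
    convolve n B (shift A) + B (suc n) * A 0  ≈⟨ convolve-snoc n B A ⟨
    convolve (suc n) B A                      ∎

  convolve-distribʳ : ∀ n (A B C : Series) → convolve n (A ⊕ B) C ≈ convolve n A C + convolve n B C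
  convolve-distribʳ zero    A B C = distribʳ _ _ _
  convolve-distribʳ (suc n) A B C = begin
    (A 0 + B 0) * C (suc n) + convolve n (shift (A ⊕ B)) C
      ≈⟨ +-cong (distribʳ _ _ _) (convolve-distribʳ n (shift A) (shift B) C) ⟩
    (A 0 * C (suc n) + B 0 * C (suc n)) + (convolve n (shift A) C + convolve n (shift B) C)
      ≈⟨ +-interchange _ _ _ _ ⟩
    (A 0 * C (suc n) + convolve n (shift A) C) + (B 0 * C (suc n) + convolve n (shift B) C) ∎
    where
    +-interchange : ∀ a b c d → (a + b) + (c + d) ≈ (a + c) + (b + d)
    +-interchange = solve 4 (λ a b c d → (a :+ b) :+ (c :+ d) := (a :+ c) :+ (b :+ d)) refl

  convolve-assoc : ∀ n (A B C : Series) → convolve n (A ⊗ B) C ≈ convolve n A (B ⊗ C)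
  convolve-assoc zero    A B C = *-assoc _ _ _
  convolve-assoc (suc n) A B C = begin
    (A 0 * B 0) * C (suc n) + convolve n (shift (A ⊗ B)) C
      ≈⟨ +-congˡ (convolve-distribʳ n (λ k → A 0 * B (suc k)) (shift A ⊗ B) C) ⟩
    (A 0 * B 0) * C (suc n) + (convolve n (λ k → A 0 * B (suc k)) C + convolve n (shift A ⊗ B) C)
      ≈⟨ +-congˡ (+-cong (convolve-*ˡ n (A 0) (shift B) C) (convolve-assoc n (shift A) B C)) ⟩
    (A 0 * B 0) * C (suc n) + (A 0 * convolve n (shift B) C + convolve n (shift A) (B ⊗ C))
      ≈⟨ regroup _ _ _ _ _ ⟩
    A 0 * (B 0 * C (suc n) + convolve n (shift B) C) + convolve n (shift A) (B ⊗ C) ∎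
    where
    regroup : ∀ a b c x y → (a * b) * c + (a * x + y) ≈ a * (b * c + x) + y
    regroup = solve 5 (λ a b c x y → (a :* b) :* c :+ (a :* x :+ y) := a :* (b :* c :+ x) :+ y) refl

  seriesRing : CommutativeRing κ ℓ
  seriesRing = record
    { Carrier = Series
    ; _≈_ = λ A B → ∀ n → A n ≈ B n
    ; _+_ = _⊕_
    ; _*_ = _⊗_
    ; -_ = λ A n → - A n
    ; 0# = λ _ → 0#
    ; 1# = cst 1#
    ; isCommutativeRing = record
      { isRing = record
        { +-isAbelianGroup = record
          { isGroup = record
            { isMonoid = record
              { isSemigroup = record
                { isMagma = record
                  { isEquivalence = record
                    { refl  = λ n → refl
                    ; sym   = λ A≈B n → sym (A≈B n)
                    ; trans = λ A≈B B≈C n → trans (A≈B n) (B≈C n) }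
                  ; ∙-cong = λ A≈A′ B≈B′ n → +-cong (A≈A′ n) (B≈B′ n) }
                ; assoc = λ A B C n → +-assoc _ _ _ }
              ; identity = (λ A n → +-identityˡ _) , (λ A n → +-identityʳ _) }
            ; inverse = (λ A n → -‿inverseˡ _) , (λ A n → -‿inverseʳ _)
            ; ⁻¹-cong = λ A≈B n → -‿cong (A≈B n) }
          ; comm = λ A B n → +-comm _ _ }
        ; *-cong = λ A≈A′ B≈B′ n → convolve-cong n A≈A′ B≈B′
        ; *-assoc = λ A B C n → convolve-assoc n A B C
        ; *-identity = identityˡ , λ A n → trans (convolve-comm n A (cst 1#)) (identityˡ A n)
        ; distrib = (λ A B C n → trans (convolve-comm n A (B ⊕ C))
                                  (trans (convolve-distribʳ n B C A) (+-cong (convolve-comm n B A) (convolve-comm n C A))))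
                  , (λ A B C n → convolve-distribʳ n B C A) }
      ; *-comm = λ A B n → convolve-comm n A B } }
    where
    identityˡ : ∀ A n → (cst 1# ⊗ A) n ≈ A n
    identityˡ A n = trans (convolve-cstˡ n 1# A) (*-identityˡ _)

  open CommutativeRing seriesRing public
    using () renaming (_≈_ to _≈ₛ_; _+_ to _+ₛ_; _*_ to _*ₛ_; -_ to -ₛ_; _-_ to _-ₛ_; 0# to 0ₛ; 1# to 1ₛ)

  1+_x : Carrier → Series
  1+ β x = 1ₛ +ₛ cst β *ₛ X

  x² : Series
  x² = X *ₛ X

  1+x-x²-constantTerm : ∀ β (A : Series) → (1+ β x -ₛ x² *ₛ A) 0 ≈ 1#
  1+x-x²-constantTerm β A =
    solve 2 (λ β a → (con (+ 1) :+ β :* con (+ 0)) :- (con (+ 0) :* con (+ 0)) :* a := con (+ 1)) refl β (A 0)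

  cst-cong : ∀ {x y} → x ≈ y → cst x ≈ₛ cst y
  cst-cong x≈y zero    = x≈y
  cst-cong x≈y (suc n) = refl

  cst-+ : ∀ x y → cst (x + y) ≈ₛ cst x +ₛ cst y
  cst-+ x y zero    = refl
  cst-+ x y (suc n) = sym (+-identityʳ 0#)

  cst-* : ∀ x y → cst (x * y) ≈ₛ cst x *ₛ cst y
  cst-* x y zero    = refl
  cst-* x y (suc n) = sym (trans (convolve-cstˡ (suc n) x (cst y)) (zeroʳ x))

  cst-neg : ∀ x → cst (- x) ≈ₛ -ₛ cst x
  cst-neg x zero    = refl
  cst-neg x (suc n) = sym -0#≈0#

  cst-sub : ∀ x y → cst (x - y) ≈ₛ cst x -ₛ cst y
  cst-sub x y zero    = refl
  cst-sub x y (suc n) = sym (trans (+-identityˡ _) -0#≈0#)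

  cst-0 : cst 0# ≈ₛ 0ₛ
  cst-0 zero    = refl
  cst-0 (suc n) = refl

  constS≈cst : ∀ c → constS c ≈ₛ cst c
  constS≈cst c zero                          = refl
  constS≈cst c (suc zero)                    = refl
  constS≈cst c (suc (suc zero))              = refl
  constS≈cst c (suc (suc (suc zero)))        = refl
  constS≈cst c (suc (suc (suc (suc zero))))  = refl
  constS≈cst c (suc (suc (suc (suc (suc n))))) = refl

  cst+X*-coefficient₀ : ∀ c (B : Series) → (cst c +ₛ X *ₛ B) 0 ≈ c
  cst+X*-coefficient₀ c B = trans (+-congˡ (zeroˡ (B 0))) (+-identityʳ c)

  cst+X*-coefficient : ∀ c (B : Series) n → (cst c +ₛ X *ₛ B) (suc n) ≈ B n
  cst+X*-coefficient c B n = trans (+-identityˡ _) (convolve-Xˡ n B)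

  poly-horner : ∀ p₀ p₁ p₂ p₃ p₄ →
    poly p₀ p₁ p₂ p₃ p₄ ≈ₛ cst p₀ +ₛ X *ₛ (cst p₁ +ₛ X *ₛ (cst p₂ +ₛ X *ₛ (cst p₃ +ₛ X *ₛ cst p₄)))
  poly-horner p₀ p₁ p₂ p₃ p₄ = step p₀ p₁ p₂ p₃ p₄ (step p₁ p₂ p₃ p₄ 0#
    (step p₂ p₃ p₄ 0# 0# (step p₃ p₄ 0# 0# 0# (constS≈cst p₄))))
    where
    shift-poly : ∀ q₀ q₁ q₂ q₃ q₄ n → poly q₀ q₁ q₂ q₃ q₄ (suc n) ≈ poly q₁ q₂ q₃ q₄ 0# n
    shift-poly q₀ q₁ q₂ q₃ q₄ zero                          = refl
    shift-poly q₀ q₁ q₂ q₃ q₄ (suc zero)                    = refl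
    shift-poly q₀ q₁ q₂ q₃ q₄ (suc (suc zero))              = refl
    shift-poly q₀ q₁ q₂ q₃ q₄ (suc (suc (suc zero)))        = refl
    shift-poly q₀ q₁ q₂ q₃ q₄ (suc (suc (suc (suc zero))))  = refl
    shift-poly q₀ q₁ q₂ q₃ q₄ (suc (suc (suc (suc (suc n))))) = refl
    step : ∀ q₀ q₁ q₂ q₃ q₄ {T} → poly q₁ q₂ q₃ q₄ 0# ≈ₛ T → poly q₀ q₁ q₂ q₃ q₄ ≈ₛ cst q₀ +ₛ X *ₛ T
    step q₀ q₁ q₂ q₃ q₄ {T} tail≈T zero    = sym (cst+X*-coefficient₀ q₀ T)
    step q₀ q₁ q₂ q₃ q₄ {T} tail≈T (suc n) =
      trans (shift-poly q₀ q₁ q₂ q₃ q₄ n) (trans (tail≈T n) (sym (cst+X*-coefficient q₀ T n)))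

  -- K / (1 + β x - γ x²)
  quotient : Carrier → Carrier → Series → Series
  quotient β γ K zero          = K 0
  quotient β γ K (suc zero)    = K 1 - β * quotient β γ K 0
  quotient β γ K (suc (suc n)) = (K (suc (suc n)) - β * quotient β γ K (suc n)) + γ * quotient β γ K n

  quotient-recurrence : ∀ β γ K →
    quotient β γ K +ₛ cst β *ₛ (X *ₛ quotient β γ K) -ₛ cst γ *ₛ (X *ₛ (X *ₛ quotient β γ K)) ≈ₛ K
  quotient-recurrence β γ K n =
    trans (+-cong (+-congˡ (convolve-cstˡ n β (X *ₛ Q))) (-‿cong (convolve-cstˡ n γ (X *ₛ (X *ₛ Q))))) (recurrence n)
    where
    Q = quotient β γ K
    recurrence : ∀ n → (Q n + β * (X *ₛ Q) n) - γ * (X *ₛ (X *ₛ Q)) n ≈ K n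
    recurrence zero = solve 3 (λ q β γ →
      (q :+ β :* (con (+ 0) :* q)) :- γ :* (con (+ 0) :* (con (+ 0) :* q)) := q) refl (Q 0) β γ
    recurrence (suc zero) = begin
      (Q 1 + β * (X *ₛ Q) 1) - γ * (X *ₛ (X *ₛ Q)) 1
        ≈⟨ +-cong (+-congˡ (*-congˡ (convolve-Xˡ 0 Q)))
                  (-‿cong (*-congˡ (trans (convolve-Xˡ 0 (X *ₛ Q)) (zeroˡ _)))) ⟩
      ((K 1 - β * Q 0) + β * Q 0) - γ * 0#
        ≈⟨ solve 4 (λ k q β γ → ((k :- β :* q) :+ β :* q) :- γ :* con (+ 0) := k) refl (K 1) (Q 0) β γ ⟩
      K 1 ∎
    recurrence (suc (suc n)) = begin
      (Q (2 ℕ.+ n) + β * (X *ₛ Q) (2 ℕ.+ n)) - γ * (X *ₛ (X *ₛ Q)) (2 ℕ.+ n)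
        ≈⟨ +-cong (+-congˡ (*-congˡ (convolve-Xˡ (suc n) Q)))
                  (-‿cong (*-congˡ (trans (convolve-Xˡ (suc n) (X *ₛ Q)) (convolve-Xˡ n Q)))) ⟩
      (((K (2 ℕ.+ n) - β * Q (suc n)) + γ * Q n) + β * Q (suc n)) - γ * Q n
        ≈⟨ solve 5 (λ k q₁ q₀ β γ → (((k :- β :* q₁) :+ γ :* q₀) :+ β :* q₁) :- γ :* q₀ := k)
                 refl (K (2 ℕ.+ n)) (Q (suc n)) (Q n) β γ ⟩
      K (2 ℕ.+ n) ∎

  convolve-vanishing : ∀ n (A B : Series) → (∀ m → m ℕ.≤ n → B m ≈ 0#) → convolve n A B ≈ 0#
  convolve-vanishing zero    A B B≈0 = trans (*-congˡ (B≈0 0 ℕ.z≤n)) (zeroʳ _)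
  convolve-vanishing (suc n) A B B≈0 =
    trans (+-cong (trans (*-congˡ (B≈0 (suc n) ℕ.≤-refl)) (zeroʳ _))
                  (convolve-vanishing n (shift A) B (λ m m≤n → B≈0 m (ℕ.m≤n⇒m≤1+n m≤n))))
          (+-identityʳ 0#)

  *ₛ-cancelˡ : ∀ (S A B : Series) → S 0 ≈ 1# → S *ₛ A ≈ₛ S *ₛ B → A ≈ₛ B
  *ₛ-cancelˡ S A B S₀≈1 SA≈SB n = x∙y⁻¹≈ε⇒x≈y (A n) (B n) (vanishes n n ℕ.≤-refl)
    where
    open import Algebra.Properties.Ring (CommutativeRing.ring seriesRing) using (x[y-z]≈xy-xz)
    S[A-B]≈0 : ∀ n → convolve n S (A -ₛ B) ≈ 0#
    S[A-B]≈0 n = trans (x[y-z]≈xy-xz S A B n) (trans (+-congʳ (SA≈SB n)) (-‿inverseʳ _))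
    S₀*x≈0⇒x≈0 : ∀ {x} → S 0 * x ≈ 0# → x ≈ 0#
    S₀*x≈0⇒x≈0 {x} S₀x≈0 = trans (sym (*-identityˡ x)) (trans (*-congʳ (sym S₀≈1)) S₀x≈0)
    -- strong induction: coefficient m of S (A - B) is S₀ (A - B)ₘ plus earlier coefficients
    vanishes : ∀ n m → m ℕ.≤ n → (A -ₛ B) m ≈ 0#
    vanishes n       zero    _           = S₀*x≈0⇒x≈0 (S[A-B]≈0 0)
    vanishes (suc n) (suc m) (ℕ.s≤s m≤n) = S₀*x≈0⇒x≈0 (begin
      S 0 * (A -ₛ B) (suc m)                                                ≈⟨ +-identityʳ _ ⟨
      S 0 * (A -ₛ B) (suc m) + 0#                                           ≈⟨ +-congˡ earlier ⟨
      S 0 * (A -ₛ B) (suc m) + convolve m (shift S) (A -ₛ B)                ≈⟨ S[A-B]≈0 (suc m) ⟩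
      0#                                                                    ∎)
      where
      earlier : convolve m (shift S) (A -ₛ B) ≈ 0#
      earlier = convolve-vanishing m (shift S) (A -ₛ B) (λ k k≤m → vanishes n k (ℕ.≤-trans k≤m m≤n))

module HankelShift {κ ℓ : Level} (F : Field κ ℓ) where
  open Field F hiding (zero)
  open FieldTheory F hiding (_≈ₛ_)
  open IntegerCoefficients commutativeRing
  open Determinant F
  open PowerSeries F
  open import Relation.Binary.Reasoning.Setoid setoid

  hankelMatrix : ∀ n → Series → Matrix n
  hankelMatrix n A i j = A (toℕ i ℕ.+ toℕ j)

  hankel-cong : ∀ n {A B : Series} → A ≈ₛ B → hankel n A ≈ hankel n B
  hankel-cong n A≈B = det-cong n (λ i j → A≈B (toℕ i ℕ.+ toℕ j))

  toeplitz : Series → ℕ → ℕ → Carrier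
  toeplitz D zero    zero    = D 0
  toeplitz D zero    (suc k) = 0#
  toeplitz D (suc i) zero    = D (suc i)
  toeplitz D (suc i) (suc k) = toeplitz D i k

  toeplitz-diagonal : ∀ D i → toeplitz D i i ≡.≡ D 0
  toeplitz-diagonal D zero    = ≡.refl
  toeplitz-diagonal D (suc i) = toeplitz-diagonal D i

  toeplitz-above : ∀ D i k → i ℕ.< k → toeplitz D i k ≡.≡ 0#
  toeplitz-above D zero    (suc k) _           = ≡.refl
  toeplitz-above D (suc i) (suc k) (ℕ.s≤s i<k) = toeplitz-above D i k i<k

  sumFin-toeplitz : ∀ N i (A D : Series) → i ℕ.< N →
                    sumFin N (λ k → toeplitz D i (toℕ k) * A (toℕ k)) ≈ convolve i A D
  sumFin-toeplitz (suc N) zero    A D _ = begin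
    D 0 * A 0 + sumFin N (λ k → 0# * A (suc (toℕ k)))  ≈⟨ +-cong (*-comm _ _) (sumFin-zero N (λ k → zeroˡ _)) ⟩
    A 0 * D 0 + 0#                                      ≈⟨ +-identityʳ _ ⟩
    A 0 * D 0                                           ∎
  sumFin-toeplitz (suc N) (suc i) A D (ℕ.s≤s i<N) = +-cong (*-comm _ _) (sumFin-toeplitz N i (shift A) D i<N)

  -- When A D = 1 and G k = - D (k + 2), the (lower unitriangular) Toeplitz matrix of D turns
  -- the Hankel matrix of A into a block matrix whose lower-right block is the Hankel matrix
  -- of G times the (upper unitriangular) Toeplitz matrix of A.
  module _ (A D : Series) (AD-tail≈0 : ∀ n → convolve (suc n) A D ≈ 0#) where
    private
      G : Series
      G k = - D (suc (suc k))

      W : ℕ → ℕ → Carrier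
      W j i = convolve i (λ k → A (k ℕ.+ j)) D

      W-suc : ∀ j i → W j (suc i) ≈ A j * D (suc i) + W (suc j) i
      W-suc j i = +-congˡ (convolve-cong i (λ k → reflexive (≡.cong A (≡.sym (ℕ.+-suc k j)))) (λ _ → refl))

      W-zero : ∀ i → W 0 (suc i) ≈ 0#
      W-zero i = trans (convolve-cong (suc i) (λ k → reflexive (≡.cong A (ℕ.+-identityʳ k))) (λ _ → refl)) (AD-tail≈0 i)

      convolve-tail : ∀ j i → W (suc j) (suc i) ≈ convolve j (λ m → G (i ℕ.+ m)) A
      convolve-tail zero i = begin
        W 1 (suc i)                                ≈⟨ y≈[x+y]-x _ _ ⟩
        (A 0 * D (suc (suc i)) + W 1 (suc i)) - A 0 * D (suc (suc i))
                                                   ≈⟨ +-congʳ (trans (sym (W-suc 0 (suc i))) (W-zero (suc i))) ⟩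
        0# - A 0 * D (suc (suc i))                 ≈⟨ rearrange _ _ ⟩
        G i * A 0                                  ≈⟨ *-congʳ (reflexive (≡.cong G (≡.sym (ℕ.+-identityʳ i)))) ⟩
        G (i ℕ.+ 0) * A 0                          ∎
        where
        y≈[x+y]-x : ∀ x y → y ≈ (x + y) - x
        y≈[x+y]-x = solve 2 (λ x y → y := (x :+ y) :- x) refl
        rearrange : ∀ a d → 0# - a * d ≈ (- d) * a
        rearrange = solve 2 (λ a d → con (+ 0) :- a :* d := (:- d) :* a) refl
      convolve-tail (suc j) i = begin
        W (suc (suc j)) (suc i)
          ≈⟨ y≈[x+y]-x _ _ ⟩
        (A (suc j) * D (suc (suc i)) + W (suc (suc j)) (suc i)) - A (suc j) * D (suc (suc i))
          ≈⟨ +-congʳ (trans (sym (W-suc (suc j) (suc i))) (convolve-tail j (suc i))) ⟩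
        convolve j (λ m → G (suc i ℕ.+ m)) A - A (suc j) * D (suc (suc i))
          ≈⟨ rearrange _ _ _ ⟩
        G i * A (suc j) + convolve j (λ m → G (suc i ℕ.+ m)) A
          ≈⟨ +-cong (*-congʳ (reflexive (≡.cong G (≡.sym (ℕ.+-identityʳ i)))))
                    (convolve-cong j (λ m → reflexive (≡.cong G (≡.sym (ℕ.+-suc i m)))) (λ _ → refl)) ⟩
        convolve (suc j) (λ m → G (i ℕ.+ m)) A ∎
        where
        y≈[x+y]-x : ∀ x y → y ≈ (x + y) - x
        y≈[x+y]-x = solve 2 (λ x y → y := (x :+ y) :- x) refl
        rearrange : ∀ v a d → v - a * d ≈ (- d) * a + v
        rearrange = solve 3 (λ v a d → v :- a :* d := (:- d) :* a :+ v) refl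

    hankel-suc-normalised : ∀ n → D 0 ≈ 1# → convolve 0 A D ≈ 1# → hankel (suc n) A ≈ hankel n G
    hankel-suc-normalised n D₀≈1 AD₀≈1 = begin
      det (suc n) H
        ≈⟨ det-lowerUnitriangular-· (suc n) T H T-lower ⟨
      det (suc n) (T · H)
        ≈⟨ det-firstColumnZero n (T · H) (λ i → trans (TH≈W (suc i) zero) (W-zero (toℕ i))) ⟩
      (T · H) zero zero * det n (λ i j → (T · H) (suc i) (suc j))
        ≈⟨ *-cong (trans (TH≈W zero zero) AD₀≈1) (det-cong n lowerRight) ⟩
      1# * det n (hankelMatrix n G · U)
        ≈⟨ *-identityˡ _ ⟩
      det n (hankelMatrix n G · U)
        ≈⟨ det-·-upperUnitriangular n (hankelMatrix n G) U U-upper ⟩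
      hankel n G ∎
      where
      H : Matrix (suc n)
      H = hankelMatrix (suc n) A
      T : Matrix (suc n)
      T i k = toeplitz D (toℕ i) (toℕ k)
      U : Matrix n
      U k j = toeplitz A (toℕ j) (toℕ k)
      A₀≈1 : A 0 ≈ 1#
      A₀≈1 = trans (sym (*-identityʳ _)) (trans (*-congˡ (sym D₀≈1)) AD₀≈1)
      T-lower : IsLowerUnitriangular T
      T-lower = (λ i → trans (reflexive (toeplitz-diagonal D (toℕ i))) D₀≈1)
              , (λ i k i<k → reflexive (toeplitz-above D (toℕ i) (toℕ k) i<k))
      U-upper : IsUpperUnitriangular U
      U-upper = (λ i → trans (reflexive (toeplitz-diagonal A (toℕ i))) A₀≈1)
              , (λ i k i<k → reflexive (toeplitz-above A (toℕ i) (toℕ k) i<k))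
      TH≈W : ∀ i j → (T · H) i j ≈ W (toℕ j) (toℕ i)
      TH≈W i j = sumFin-toeplitz (suc n) (toℕ i) (λ k → A (k ℕ.+ toℕ j)) D (Fin.toℕ<n i)
      lowerRight : ∀ i j → (T · H) (suc i) (suc j) ≈ (hankelMatrix n G · U) i j
      lowerRight i j = begin
        (T · H) (suc i) (suc j)                               ≈⟨ TH≈W (suc i) (suc j) ⟩
        W (suc (toℕ j)) (suc (toℕ i))                        ≈⟨ convolve-tail (toℕ j) (toℕ i) ⟩
        convolve (toℕ j) (λ m → G (toℕ i ℕ.+ m)) A          ≈⟨ sumFin-toeplitz n (toℕ j) _ A (Fin.toℕ<n j) ⟨
        sumFin n (λ k → toeplitz A (toℕ j) (toℕ k) * G (toℕ i ℕ.+ toℕ k))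
                                                              ≈⟨ sumFin-cong n (λ k → *-comm _ _) ⟩
        (hankelMatrix n G · U) i j                            ∎

  hankel-suc : ∀ n (A D : Series) f₀ → ¬ f₀ ≈ 0# → D 0 ≈ 1# → A *ₛ D ≈ₛ cst f₀ →
               hankel (suc n) A ≈ f₀ ^ suc n * hankel n (λ k → - D (suc (suc k)))
  hankel-suc n A D f₀ f₀≉0 D₀≈1 AD≈f₀ = begin
    hankel (suc n) A
      ≈⟨ det-cong (suc n) (λ i j → f₀*[y*x]≈x (A (toℕ i ℕ.+ toℕ j))) ⟨
    det (suc n) (λ i j → f₀ * A′ (toℕ i ℕ.+ toℕ j))
      ≈⟨ det-scale (suc n) f₀ (hankelMatrix (suc n) A′) ⟩
    f₀ ^ suc n * hankel (suc n) A′
      ≈⟨ *-congˡ (hankel-suc-normalised A′ D A′D≈0 n D₀≈1 A′D₀≈1) ⟩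
    f₀ ^ suc n * hankel n (λ k → - D (suc (suc k))) ∎
    where
    y = proj₁ (inverse f₀ f₀≉0)
    f₀y≈1 : f₀ * y ≈ 1#
    f₀y≈1 = proj₂ (inverse f₀ f₀≉0)
    A′ : Series
    A′ k = y * A k
    f₀*[y*x]≈x : ∀ x → f₀ * (y * x) ≈ x
    f₀*[y*x]≈x x = trans (sym (*-assoc _ _ _)) (trans (*-congʳ f₀y≈1) (*-identityˡ x))
    A′D₀≈1 : convolve 0 A′ D ≈ 1#
    A′D₀≈1 = trans (convolve-*ˡ 0 y A D) (trans (*-congˡ (AD≈f₀ 0)) (trans (*-comm _ _) f₀y≈1))
    A′D≈0 : ∀ m → convolve (suc m) A′ D ≈ 0#
    A′D≈0 m = trans (convolve-*ˡ (suc m) y A D) (trans (*-congˡ (AD≈f₀ (suc m))) (zeroʳ y))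

  hankel-shift : ∀ n (A G : Series) β f₀ → ¬ f₀ ≈ 0# → A *ₛ (1+ β x -ₛ x² *ₛ G) ≈ₛ cst f₀ →
                 hankel (suc n) A ≈ f₀ ^ suc n * hankel n G
  hankel-shift n A G β f₀ f₀≉0 A*D≈f₀ = begin
    hankel (suc n) A                                 ≈⟨ hankel-suc n A D f₀ f₀≉0 (1+x-x²-constantTerm β G) A*D≈f₀ ⟩
    f₀ ^ suc n * hankel n (λ k → - D (suc (suc k)))  ≈⟨ *-congˡ (hankel-cong n D-tail) ⟩
    f₀ ^ suc n * hankel n G                          ∎
    where
    D = 1+ β x -ₛ x² *ₛ G
    D-tail : ∀ k → - D (suc (suc k)) ≈ G k
    D-tail k = begin
      - ((0# + convolve (suc (suc k)) (cst β) X) - convolve (suc (suc k)) x² G)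
        ≈⟨ -‿cong (+-cong (+-congˡ (convolve-cstˡ (suc (suc k)) β X)) (-‿cong x²G)) ⟩
      - ((0# + β * 0#) - G k)
        ≈⟨ solve 2 (λ β g → :- ((con (+ 0) :+ β :* con (+ 0)) :- g) := g) refl β (G k) ⟩
      G k ∎
      where
      x²G : convolve (suc (suc k)) x² G ≈ G k
      x²G = trans (convolve-assoc (suc (suc k)) X X G) (trans (convolve-Xˡ (suc k) (X *ₛ G)) (convolve-Xˡ k G))

-- y plays the role of x², and u that of 1 + b x.
module QuadraticRecurrence {c ℓ : Level} (R : CommutativeRing c ℓ) where
  open CommutativeRing R
  open IntegerCoefficients R
  open import Relation.Binary.Reasoning.Setoid setoid

  module _ {u y G a c d δ : Carrier}
           (G-quadratic : (G + c) * (u - y * G) ≈ a * (u - y * d))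
           (δ-def : (a - c) * δ ≈ a * d) where

    recurrence-G : G * (u - y * δ) - y * G * (G + c - δ) ≈ (a - c) * (u - y * δ)
    recurrence-G = begin
      G * (u - y * δ) - y * G * (G + c - δ)   ≈⟨ solve 5 (λ u y G c δ →
        G :* (u :- y :* δ) :- y :* G :* (G :+ c :- δ) := (G :+ c) :* (u :- y :* G) :- c :* u) refl u y G c δ ⟩
      (G + c) * (u - y * G) - c * u           ≈⟨ +-congʳ G-quadratic ⟩
      a * (u - y * d) - c * u                 ≈⟨ solve 5 (λ u y a c d →
        a :* (u :- y :* d) :- c :* u := (a :- c) :* u :- y :* (a :* d)) refl u y a c d ⟩
      (a - c) * u - y * (a * d)               ≈⟨ +-congˡ (-‿cong (*-congˡ (sym δ-def))) ⟩
      (a - c) * u - y * ((a - c) * δ)         ≈⟨ solve 5 (λ u y a c δ →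
        (a :- c) :* u :- y :* ((a :- c) :* δ) := (a :- c) :* (u :- y :* δ)) refl u y a c δ ⟩
      (a - c) * (u - y * δ)                   ∎

    recurrence-E : (G + c - δ) * (u - y * ((G + c - δ) - (c - (δ + δ)))) ≈ (a - δ) * (u - y * δ)
    recurrence-E = begin
      (G + c - δ) * (u - y * ((G + c - δ) - (c - (δ + δ))))
        ≈⟨ solve 5 (λ u y G c δ →
             (G :+ c :- δ) :* (u :- y :* ((G :+ c :- δ) :- (c :- (δ :+ δ))))
             := (G :+ c) :* (u :- y :* G) :- δ :* u :- y :* (c :* δ :- δ :* δ)) refl u y G c δ ⟩
      (G + c) * (u - y * G) - δ * u - y * (c * δ - δ * δ)
        ≈⟨ +-congʳ (+-congʳ G-quadratic) ⟩
      a * (u - y * d) - δ * u - y * (c * δ - δ * δ)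
        ≈⟨ solve 6 (λ u y a c d δ →
             a :* (u :- y :* d) :- δ :* u :- y :* (c :* δ :- δ :* δ)
             := (a :- δ) :* u :- y :* (a :* d) :- y :* (c :* δ :- δ :* δ)) refl u y a c d δ ⟩
      (a - δ) * u - y * (a * d) - y * (c * δ - δ * δ)
        ≈⟨ +-congʳ (+-congˡ (-‿cong (*-congˡ (sym δ-def)))) ⟩
      (a - δ) * u - y * ((a - c) * δ) - y * (c * δ - δ * δ)
        ≈⟨ solve 5 (λ u y a c δ →
             (a :- δ) :* u :- y :* ((a :- c) :* δ) :- y :* (c :* δ :- δ :* δ)
             := (a :- δ) :* (u :- y :* δ)) refl u y a c δ ⟩
      (a - δ) * (u - y * δ) ∎

module ContinuedFraction {κ ℓ : Level} (F : Field κ ℓ) where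
  open Field F hiding (zero)
  open FieldTheory F hiding (_≈ₛ_)
  open PowerSeries F
  open HankelShift F
  module 𝔽 = IntegerCoefficients commutativeRing
  module S = CommutativeRing seriesRing
  open IntegerCoefficients seriesRing
  open import Relation.Binary.Reasoning.Setoid S.setoid

  denominator : ∀ b c d (E : Series) →
    E *ₛ poly 0# 0# (- 1#) (- b) d +ₛ poly 1# b c 0# 0# ≈ₛ
    1+ b x -ₛ x² *ₛ ((1+ b x -ₛ x² *ₛ cst d) *ₛ E -ₛ cst c)
  denominator b c d E = begin
    E *ₛ poly 0# 0# (- 1#) (- b) d +ₛ poly 1# b c 0# 0#
      ≈⟨ S.+-cong (S.*-congˡ P-horner) Q-horner ⟩
    E *ₛ (0ₛ +ₛ X *ₛ (0ₛ +ₛ X *ₛ (-ₛ 1ₛ +ₛ X *ₛ (-ₛ cst b +ₛ X *ₛ cst d))))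
      +ₛ (1ₛ +ₛ X *ₛ (cst b +ₛ X *ₛ (cst c +ₛ X *ₛ (0ₛ +ₛ X *ₛ 0ₛ))))
      ≈⟨ solve 5 (λ E X B C D →
           E :* (con (+ 0) :+ X :* (con (+ 0) :+ X :* (:- con (+ 1) :+ X :* (:- B :+ X :* D))))
           :+ (con (+ 1) :+ X :* (B :+ X :* (C :+ X :* (con (+ 0) :+ X :* con (+ 0)))))
           := con (+ 1) :+ B :* X :- X :* X :* ((con (+ 1) :+ B :* X :- X :* X :* D) :* E :- C))
         S.refl E X (cst b) (cst c) (cst d) ⟩
    1+ b x -ₛ x² *ₛ ((1+ b x -ₛ x² *ₛ cst d) *ₛ E -ₛ cst c) ∎
    where
    P-horner = S.trans (poly-horner 0# 0# (- 1#) (- b) d)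
      (S.+-cong cst-0 (S.*-congˡ (S.+-cong cst-0 (S.*-congˡ
        (S.+-cong (cst-neg 1#) (S.*-congˡ (S.+-congʳ (cst-neg b))))))))
    Q-horner = S.trans (poly-horner 1# b c 0# 0#)
      (S.+-congˡ (S.*-congˡ (S.+-congˡ (S.*-congˡ (S.+-congˡ (S.*-congˡ (S.+-cong cst-0 (S.*-congˡ cst-0))))))))

  *ₛ-quotient : ∀ β γ K → (1+ β x -ₛ x² *ₛ cst γ) *ₛ quotient β γ K ≈ₛ K
  *ₛ-quotient β γ K = S.trans expand (quotient-recurrence β γ K)
    where
    Q = quotient β γ K
    expand : (1+ β x -ₛ x² *ₛ cst γ) *ₛ Q ≈ₛ Q +ₛ cst β *ₛ (X *ₛ Q) -ₛ cst γ *ₛ (X *ₛ (X *ₛ Q))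
    expand = solve 4 (λ B X C Q → (con (+ 1) :+ B :* X :- X :* X :* C) :* Q
                                  := Q :+ B :* (X :* Q) :- C :* (X :* (X :* Q))) S.refl (cst β) X (cst γ) Q

  module Step (a b c d : Carrier) (E : Series)
              (E-eq : E *ₛ (E *ₛ poly 0# 0# (- 1#) (- b) d +ₛ poly 1# b c 0# 0#) ≈ₛ constS a) where

    G : Series
    G = (1+ b x -ₛ x² *ₛ cst d) *ₛ E -ₛ cst c

    E-quotient : E *ₛ (1+ b x -ₛ x² *ₛ G) ≈ₛ cst a
    E-quotient = S.trans (S.*-congˡ (S.sym (denominator b c d E))) (S.trans E-eq (constS≈cst a))

    E₀≈a : E 0 ≈ a
    E₀≈a = trans (sym (*-identityʳ _)) (trans (*-congˡ (sym (1+x-x²-constantTerm b G))) (E-quotient 0))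

    G₀≈a-c : G 0 ≈ a - c
    G₀≈a-c = trans (𝔽.solve 4 (λ b d e c →
      ((𝔽.con (+ 1) 𝔽.:+ b 𝔽.:* 𝔽.con (+ 0)) 𝔽.:- (𝔽.con (+ 0) 𝔽.:* 𝔽.con (+ 0)) 𝔽.:* d) 𝔽.:* e 𝔽.:- c
      𝔽.:= e 𝔽.:- c) refl b d (E 0) c) (+-congʳ E₀≈a)

    G-quadratic : (G +ₛ cst c) *ₛ (1+ b x -ₛ x² *ₛ G) ≈ₛ cst a *ₛ (1+ b x -ₛ x² *ₛ cst d)
    G-quadratic = begin
      (G +ₛ cst c) *ₛ (1+ b x -ₛ x² *ₛ G)                ≈⟨ S.*-congʳ (solve 3 (λ R E C → R :* E :- C :+ C := R :* E)
                                                               S.refl (1+ b x -ₛ x² *ₛ cst d) E (cst c)) ⟩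
      (1+ b x -ₛ x² *ₛ cst d) *ₛ E *ₛ (1+ b x -ₛ x² *ₛ G) ≈⟨ S.*-assoc _ _ _ ⟩
      (1+ b x -ₛ x² *ₛ cst d) *ₛ (E *ₛ (1+ b x -ₛ x² *ₛ G)) ≈⟨ S.*-congˡ E-quotient ⟩
      (1+ b x -ₛ x² *ₛ cst d) *ₛ cst a                   ≈⟨ S.*-comm _ _ ⟩
      cst a *ₛ (1+ b x -ₛ x² *ₛ cst d)                   ∎

    hankel-E : ¬ a ≈ 0# → ∀ k → hankel (suc k) E ≈ a ^ suc k * hankel k G
    hankel-E a≉0 k = hankel-shift k E G b a a≉0 E-quotient

    module Next (a-c≉0 : ¬ a - c ≈ 0#) where
      δ : Carrier
      δ = a * d * proj₁ (inverse (a - c) a-c≉0)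

      δ-def : (a - c) * δ ≈ a * d
      δ-def = trans (𝔽.solve 3 (λ g p z → g 𝔽.:* (p 𝔽.:* z) 𝔽.:= p 𝔽.:* (g 𝔽.:* z)) refl (a - c) (a * d) _)
                    (trans (*-congˡ (proj₂ (inverse (a - c) a-c≉0))) (*-identityʳ _))

      open QuadraticRecurrence seriesRing

      δ-defₛ : (cst a -ₛ cst c) *ₛ cst δ ≈ₛ cst a *ₛ cst d
      δ-defₛ = S.trans (S.*-congʳ (S.sym (cst-sub a c))) (S.trans (S.sym (cst-* (a - c) δ))
                 (S.trans (cst-cong δ-def) (cst-* a d)))

      Sδ : Series
      Sδ = 1+ b x -ₛ x² *ₛ cst δ

      E′ : Series
      E′ = quotient b δ (G +ₛ cst c -ₛ cst δ)

      Sδ-E′ : Sδ *ₛ E′ ≈ₛ G +ₛ cst c -ₛ cst δ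
      Sδ-E′ = *ₛ-quotient b δ (G +ₛ cst c -ₛ cst δ)

      G-quotient : G *ₛ (1+ 0# x -ₛ x² *ₛ E′) ≈ₛ cst (a - c)
      G-quotient = *ₛ-cancelˡ Sδ _ _ (1+x-x²-constantTerm b (cst δ)) (begin
        Sδ *ₛ (G *ₛ (1+ 0# x -ₛ x² *ₛ E′))
          ≈⟨ S.*-congˡ (S.*-congˡ (S.+-congʳ (S.+-congˡ (S.*-congʳ cst-0)))) ⟩
        Sδ *ₛ (G *ₛ (1ₛ +ₛ 0ₛ *ₛ X -ₛ x² *ₛ E′))
          ≈⟨ solve 4 (λ S G X E → S :* (G :* (con (+ 1) :+ con (+ 0) :* X :- X :* X :* E))
                                  := G :* S :- X :* X :* G :* (S :* E)) S.refl Sδ G X E′ ⟩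
        G *ₛ Sδ -ₛ x² *ₛ G *ₛ (Sδ *ₛ E′)
          ≈⟨ S.+-congˡ (S.-‿cong (S.*-congˡ Sδ-E′)) ⟩
        G *ₛ Sδ -ₛ x² *ₛ G *ₛ (G +ₛ cst c -ₛ cst δ)
          ≈⟨ recurrence-G G-quadratic δ-defₛ ⟩
        (cst a -ₛ cst c) *ₛ Sδ
          ≈⟨ S.*-comm _ _ ⟩
        Sδ *ₛ (cst a -ₛ cst c)
          ≈⟨ S.*-congˡ (cst-sub a c) ⟨
        Sδ *ₛ cst (a - c) ∎)

      hankel-G : ∀ k → hankel (suc k) G ≈ (a - c) ^ suc k * hankel k E′
      hankel-G k = hankel-shift k G E′ 0# (a - c) a-c≉0 G-quotient

      E′-eq : E′ *ₛ (E′ *ₛ poly 0# 0# (- 1#) (- b) δ +ₛ poly 1# b (c - (δ + δ)) 0# 0#) ≈ₛ constS (a - δ)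
      E′-eq = S.trans (S.*-congˡ (denominator b (c - (δ + δ)) δ E′)) (S.trans (*ₛ-cancelˡ Sδ _ _
        (1+x-x²-constantTerm b (cst δ)) (begin
        Sδ *ₛ (E′ *ₛ (1+ b x -ₛ x² *ₛ (Sδ *ₛ E′ -ₛ cst (c - (δ + δ)))))
          ≈⟨ solve 5 (λ S E Y X C → S :* (E :* (Y :- X :* X :* (S :* E :- C)))
                                    := (S :* E) :* (Y :- X :* X :* (S :* E :- C)))
                     S.refl Sδ E′ (1+ b x) X (cst (c - (δ + δ))) ⟩
        Sδ *ₛ E′ *ₛ (1+ b x -ₛ x² *ₛ (Sδ *ₛ E′ -ₛ cst (c - (δ + δ))))
          ≈⟨ S.*-cong Sδ-E′ (S.+-congˡ (S.-‿cong (S.*-congˡ (S.+-cong Sδ-E′ (S.-‿cong cst-c-2δ))))) ⟩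
        (G +ₛ cst c -ₛ cst δ) *ₛ (1+ b x -ₛ x² *ₛ ((G +ₛ cst c -ₛ cst δ) -ₛ (cst c -ₛ (cst δ +ₛ cst δ))))
          ≈⟨ recurrence-E G-quadratic δ-defₛ ⟩
        (cst a -ₛ cst δ) *ₛ Sδ
          ≈⟨ S.*-comm _ _ ⟩
        Sδ *ₛ (cst a -ₛ cst δ)
          ≈⟨ S.*-congˡ (cst-sub a δ) ⟨
        Sδ *ₛ cst (a - δ) ∎)) (S.sym (constS≈cst (a - δ))))
        where
        cst-c-2δ : cst (c - (δ + δ)) ≈ₛ cst c -ₛ (cst δ +ₛ cst δ)
        cst-c-2δ = S.trans (cst-sub c (δ + δ)) (S.+-congˡ (S.-‿cong (cst-+ δ δ)))

module ClosedForm {κ ℓ : Level} (F : Field κ ℓ) where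
  open import Data.Product using (_×_)
  open Field F hiding (zero)
  open FieldTheory F hiding (_≈ₛ_)
  open IntegerCoefficients commutativeRing
  open Determinant F using (sign-+; sign-*-self)
  open PowerSeries F using (_≈ₛ_; _*ₛ_; _+ₛ_)
  open import Relation.Binary.Reasoning.Setoid setoid

  ^-congˡ : ∀ {x y} n → x ≈ y → x ^ n ≈ y ^ n
  ^-congˡ zero    x≈y = refl
  ^-congˡ (suc n) x≈y = *-cong x≈y (^-congˡ n x≈y)

  ^-congʳ : ∀ x {m n} → m ≡.≡ n → x ^ m ≈ x ^ n
  ^-congʳ x m≡n = reflexive (≡.cong (x ^_) m≡n)

  ^-homo-* : ∀ x m n → x ^ (m ℕ.+ n) ≈ x ^ m * x ^ n
  ^-homo-* x zero    n = sym (*-identityˡ _)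
  ^-homo-* x (suc m) n = trans (*-congˡ (^-homo-* x m n)) (sym (*-assoc _ _ _))

  ^-distribʳ-* : ∀ x y n → (x * y) ^ n ≈ x ^ n * y ^ n
  ^-distribʳ-* x y zero    = sym (*-identityˡ 1#)
  ^-distribʳ-* x y (suc n) = trans (*-congˡ (^-distribʳ-* x y n))
    (solve 4 (λ x y p q → (x :* y) :* (p :* q) := (x :* p) :* (y :* q)) refl x y (x ^ n) (y ^ n))

  -‿^ : ∀ x n → (- x) ^ n ≈ sign n * x ^ n
  -‿^ x zero    = sym (*-identityˡ 1#)
  -‿^ x (suc n) = trans (*-congˡ (-‿^ x n))
    (solve 3 (λ x s p → (:- x) :* (s :* p) := (:- s) :* (x :* p)) refl x (sign n) (x ^ n))

  sign-even : ∀ k → sign (k ℕ.+ k) ≈ 1#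
  sign-even k = trans (sign-+ k k) (sign-*-self k)

  hankel-1 : ∀ (A : Series) → hankel 1 A ≈ A 0
  hankel-1 A = solve 1 (λ a → con (+ 1) :* (a :* con (+ 1)) :+ con (+ 0) := a) refl (A 0)

  -- Bookkeeping of one double step H_(m)(E) ↦ H_(m - 2)(E′), with u = c - a and C = c + d - a.
  double-step : ∀ m k r P {a u a′ C s B′ H : Carrier} → k ℕ.+ r ≡.≡ P ℕ.+ 1 → a′ * u ≈ a * C →
                H ≈ a ^ m * ((- u) ^ k * (s * (a′ ^ P * (u ^ r * B′)))) →
                H ≈ sign k * s * (a ^ (m ℕ.+ P) * (C ^ P * (u * B′)))
  double-step m k r P {a} {u} {a′} {C} {s} {B′} {H} k+r≡P+1 a′u≈aC H≈ = begin
    H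
      ≈⟨ H≈ ⟩
    a ^ m * ((- u) ^ k * (s * (a′ ^ P * (u ^ r * B′))))
      ≈⟨ *-congˡ (*-congʳ (-‿^ u k)) ⟩
    a ^ m * ((sign k * u ^ k) * (s * (a′ ^ P * (u ^ r * B′))))
      ≈⟨ solve 7 (λ A σ U s A′ R B → A :* ((σ :* U) :* (s :* (A′ :* (R :* B))))
                                   := σ :* s :* (A :* (A′ :* (U :* R) :* B))) refl _ _ _ s _ _ B′ ⟩
    sign k * s * (a ^ m * (a′ ^ P * (u ^ k * u ^ r) * B′))
      ≈⟨ *-congˡ (*-congˡ (*-congʳ (*-congˡ u^[P+1]))) ⟩
    sign k * s * (a ^ m * (a′ ^ P * (u ^ P * (u * 1#)) * B′))
      ≈⟨ *-congˡ (*-congˡ (solve 4 (λ A U u B → A :* (U :* (u :* con (+ 1))) :* B := (A :* U) :* (u :* B))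
                                   refl (a′ ^ P) (u ^ P) u B′)) ⟩
    sign k * s * (a ^ m * ((a′ ^ P * u ^ P) * (u * B′)))
      ≈⟨ *-congˡ (*-congˡ (*-congʳ (trans (sym (^-distribʳ-* a′ u P))
                                          (trans (^-congˡ P a′u≈aC) (^-distribʳ-* a C P))))) ⟩
    sign k * s * (a ^ m * ((a ^ P * C ^ P) * (u * B′)))
      ≈⟨ *-congˡ (solve 4 (λ A A′ C X → A :* ((A′ :* C) :* X) := (A :* A′) :* (C :* X)) refl _ _ _ (u * B′)) ⟩
    sign k * s * ((a ^ m * a ^ P) * (C ^ P * (u * B′)))
      ≈⟨ *-congˡ (*-congʳ (sym (^-homo-* a m P))) ⟩
    sign k * s * (a ^ (m ℕ.+ P) * (C ^ P * (u * B′))) ∎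
    where
    u^[P+1] : u ^ k * u ^ r ≈ u ^ P * (u * 1#)
    u^[P+1] = trans (sym (^-homo-* u k r)) (trans (^-congʳ u k+r≡P+1) (^-homo-* u P 1))

  -- The parameters (a - δ, c - 2δ, δ) of the next step have the same α = a (c + d - a) and β = c - 2a,
  -- and start the recurrence one step later.
  module Bseq-shift (a c d δ : Carrier) (δ-def : (a - c) * δ ≈ a * d) where
    a′ c′ : Carrier
    a′ = a - δ
    c′ = c - (δ + δ)

    c′+δ-a′≈c-a : (c′ + δ) - a′ ≈ c - a
    c′+δ-a′≈c-a = solve 3 (λ a c δ → ((c :- (δ :+ δ)) :+ δ) :- (a :- δ) := c :- a) refl a c δ

    a′[c-a]≈a[c+d-a] : a′ * (c - a) ≈ a * ((c + d) - a)
    a′[c-a]≈a[c+d-a] = begin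
      (a - δ) * (c - a)                                ≈⟨ solve 4 (λ a c d δ →
        (a :- δ) :* (c :- a) := a :* ((c :+ d) :- a) :+ ((a :- c) :* δ :- a :* d)) refl a c d δ ⟩
      a * ((c + d) - a) + ((a - c) * δ - a * d)        ≈⟨ +-congˡ (trans (+-congʳ δ-def) (-‿inverseʳ _)) ⟩
      a * ((c + d) - a) + 0#                           ≈⟨ +-identityʳ _ ⟩
      a * ((c + d) - a)                                ∎

    β′≈β : c′ - (a′ + a′) ≈ c - (a + a)
    β′≈β = solve 3 (λ a c δ → (c :- (δ :+ δ)) :- ((a :- δ) :+ (a :- δ)) := c :- (a :+ a)) refl a c δ

    α′≈α : a′ * ((c′ + δ) - a′) ≈ a * ((c + d) - a)
    α′≈α = trans (*-congˡ c′+δ-a′≈c-a) a′[c-a]≈a[c+d-a]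

    B₁ : (c′ - a′) * (c - a) ≈ (c - (a + a)) * (c - a) + a * ((c + d) - a) * 1#
    B₁ = begin
      (c′ - a′) * (c - a)                              ≈⟨ solve 4 (λ a c d δ →
        ((c :- (δ :+ δ)) :- (a :- δ)) :* (c :- a)
        := ((c :- (a :+ a)) :* (c :- a) :+ a :* ((c :+ d) :- a) :* con (+ 1)) :+ ((a :- c) :* δ :- a :* d))
        refl a c d δ ⟩
      ((c - (a + a)) * (c - a) + a * ((c + d) - a) * 1#) + ((a - c) * δ - a * d)
                                                       ≈⟨ +-congˡ (trans (+-congʳ δ-def) (-‿inverseʳ _)) ⟩
      ((c - (a + a)) * (c - a) + a * ((c + d) - a) * 1#) + 0#
                                                       ≈⟨ +-identityʳ _ ⟩
      (c - (a + a)) * (c - a) + a * ((c + d) - a) * 1# ∎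

    shifts : ∀ n → Bseq a′ c′ δ n * (c - a) ≈ Bseq a c d (suc n)
                 × Bseq a′ c′ δ (suc n) * (c - a) ≈ Bseq a c d (suc (suc n))
    shifts zero    = *-identityˡ _ , B₁
    shifts (suc n) = proj₂ (shifts n) , (begin
      ((c′ - (a′ + a′)) * Bseq a′ c′ δ (suc n) + a′ * ((c′ + δ) - a′) * Bseq a′ c′ δ n) * (c - a)
        ≈⟨ solve 5 (λ p x q y u → (p :* x :+ q :* y) :* u := p :* (x :* u) :+ q :* (y :* u)) refl _ _ _ _ _ ⟩
      (c′ - (a′ + a′)) * (Bseq a′ c′ δ (suc n) * (c - a)) + a′ * ((c′ + δ) - a′) * (Bseq a′ c′ δ n * (c - a))
        ≈⟨ +-cong (*-cong β′≈β (proj₂ (shifts n))) (*-cong α′≈α (proj₁ (shifts n))) ⟩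
      (c - (a + a)) * Bseq a c d (suc (suc n)) + a * ((c + d) - a) * Bseq a c d (suc n) ∎)

    [c-a]*Bseq′ : ∀ n → (c - a) * Bseq a′ c′ δ n ≈ Bseq a c d (suc n)
    [c-a]*Bseq′ n = trans (*-comm _ _) (proj₁ (shifts n))

  FunctionalEquation : Carrier → Carrier → Carrier → Carrier → Series → Set ℓ
  FunctionalEquation a b c d E = E *ₛ (E *ₛ poly 0# 0# (- 1#) (- b) d +ₛ poly 1# b c 0# 0#) ≈ₛ constS a

  OddHankel EvenHankel : ℕ → Carrier → Carrier → Carrier → Series → Set ℓ
  OddHankel n a c d E =
    hankel (2 ℕ.* n ℕ.+ 1) E ≈ a ^ ((n ℕ.+ 1) ℕ.* (n ℕ.+ 1)) * (((c + d) - a) ^ (n ℕ.* n) * Bseq a c d n)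
  EvenHankel n a c d E =
    hankel (2 ℕ.* n) E ≈ sign n * (a ^ (n ℕ.* (n ℕ.+ 1)) * (((c + d) - a) ^ (n ℕ.* (n ∸ 1)) * Bseq a c d n))

  module InductionStep (n : ℕ)
    (IH : ∀ a b c d E → FunctionalEquation a b c d E → (∀ m → ¬ hankel m E ≈ 0#) →
          OddHankel n a c d E × EvenHankel n a c d E)
    (a b c d : Carrier) (E : Series) (E-eq : FunctionalEquation a b c d E) (H≉0 : ∀ m → ¬ hankel m E ≈ 0#) where
    open ContinuedFraction.Step F a b c d E E-eq

    a≉0 : ¬ a ≈ 0#
    a≉0 a≈0 = H≉0 1 (trans (hankel-1 E) (trans E₀≈a a≈0))

    a-c≉0 : ¬ a - c ≈ 0#
    a-c≉0 a-c≈0 = H≉0 2 (trans (hankel-E a≉0 1)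
      (trans (*-congˡ (trans (hankel-1 G) (trans G₀≈a-c a-c≈0))) (zeroʳ _)))

    open Next a-c≉0
    open Bseq-shift a c d δ δ-def

    hankel-E-suc² : ∀ k → hankel (suc (suc k)) E ≈ a ^ suc (suc k) * ((a - c) ^ suc k * hankel k E′)
    hankel-E-suc² k = trans (hankel-E a≉0 (suc k)) (*-congˡ (hankel-G k))

    H′≉0 : ∀ m → ¬ hankel m E′ ≈ 0#
    H′≉0 m H′≈0 = H≉0 (suc (suc m))
      (trans (hankel-E-suc² m) (trans (*-congˡ (trans (*-congˡ H′≈0) (zeroʳ _))) (zeroʳ _)))

    IH′ : OddHankel n a′ c′ δ E′ × EvenHankel n a′ c′ δ E′
    IH′ = IH a′ b c′ δ E′ E′-eq H′≉0

    u C B′ : Carrier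
    u = c - a
    C = (c + d) - a
    B′ = Bseq a′ c′ δ n

    hankel-E-via-E′ : ∀ k P r {s} → hankel k E′ ≈ s * (a′ ^ P * (((c′ + δ) - a′) ^ r * B′)) →
      hankel (suc (suc k)) E ≈ a ^ suc (suc k) * ((- u) ^ suc k * (s * (a′ ^ P * (u ^ r * B′))))
    hankel-E-via-E′ k P r H′≈ = trans (hankel-E-suc² k) (*-congˡ (*-cong (^-congˡ (suc k) a-c≈-u)
      (trans H′≈ (*-congˡ (*-congˡ (*-congʳ (^-congˡ r c′+δ-a′≈c-a)))))))
      where
      a-c≈-u : a - c ≈ - u
      a-c≈-u = solve 2 (λ a c → a :- c := :- (c :- a)) refl a c

    odd : OddHankel (suc n) a c d E
    odd = begin
      hankel (2 ℕ.* suc n ℕ.+ 1) E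
        ≡⟨ ≡.cong (λ k → hankel k E) (index n) ⟩
      hankel (suc (suc (2 ℕ.* n ℕ.+ 1))) E
        ≈⟨ double-step (suc (suc (2 ℕ.* n ℕ.+ 1))) (suc (2 ℕ.* n ℕ.+ 1)) (n ℕ.* n) ((n ℕ.+ 1) ℕ.* (n ℕ.+ 1))
             (k+r n) a′[c-a]≈a[c+d-a]
             (hankel-E-via-E′ (2 ℕ.* n ℕ.+ 1) ((n ℕ.+ 1) ℕ.* (n ℕ.+ 1)) (n ℕ.* n)
                              (trans (proj₁ IH′) (sym (*-identityˡ _)))) ⟩
      sign (suc (2 ℕ.* n ℕ.+ 1)) * 1# * (a ^ (suc (suc (2 ℕ.* n ℕ.+ 1)) ℕ.+ (n ℕ.+ 1) ℕ.* (n ℕ.+ 1))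
                                          * (C ^ ((n ℕ.+ 1) ℕ.* (n ℕ.+ 1)) * (u * B′)))
        ≈⟨ *-cong (trans (*-identityʳ _) (trans (reflexive (≡.cong sign (sign-index n))) (sign-even (n ℕ.+ 1))))
                  (*-cong (^-congʳ a (a-exponent n)) (*-cong (^-congʳ C (C-exponent n)) ([c-a]*Bseq′ n))) ⟩
      1# * (a ^ ((suc n ℕ.+ 1) ℕ.* (suc n ℕ.+ 1)) * (C ^ (suc n ℕ.* suc n) * Bseq a c d (suc n)))
        ≈⟨ *-identityˡ _ ⟩
      a ^ ((suc n ℕ.+ 1) ℕ.* (suc n ℕ.+ 1)) * (C ^ (suc n ℕ.* suc n) * Bseq a c d (suc n)) ∎
      where
      index : ∀ n → 2 ℕ.* suc n ℕ.+ 1 ≡.≡ suc (suc (2 ℕ.* n ℕ.+ 1))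
      index = solve-∀
      k+r : ∀ n → suc (2 ℕ.* n ℕ.+ 1) ℕ.+ n ℕ.* n ≡.≡ (n ℕ.+ 1) ℕ.* (n ℕ.+ 1) ℕ.+ 1
      k+r = solve-∀
      sign-index : ∀ n → suc (2 ℕ.* n ℕ.+ 1) ≡.≡ (n ℕ.+ 1) ℕ.+ (n ℕ.+ 1)
      sign-index = solve-∀
      a-exponent : ∀ n → suc (suc (2 ℕ.* n ℕ.+ 1)) ℕ.+ (n ℕ.+ 1) ℕ.* (n ℕ.+ 1) ≡.≡
                         (suc n ℕ.+ 1) ℕ.* (suc n ℕ.+ 1)
      a-exponent = solve-∀
      C-exponent : ∀ n → (n ℕ.+ 1) ℕ.* (n ℕ.+ 1) ≡.≡ suc n ℕ.* suc n
      C-exponent = solve-∀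

    even : EvenHankel (suc n) a c d E
    even = begin
      hankel (2 ℕ.* suc n) E
        ≡⟨ ≡.cong (λ k → hankel k E) (index n) ⟩
      hankel (suc (suc (2 ℕ.* n))) E
        ≈⟨ double-step (suc (suc (2 ℕ.* n))) (suc (2 ℕ.* n)) (n ℕ.* (n ∸ 1)) (n ℕ.* (n ℕ.+ 1))
             (k+r n) a′[c-a]≈a[c+d-a]
             (hankel-E-via-E′ (2 ℕ.* n) (n ℕ.* (n ℕ.+ 1)) (n ℕ.* (n ∸ 1)) (proj₂ IH′)) ⟩
      sign (suc (2 ℕ.* n)) * sign n * (a ^ (suc (suc (2 ℕ.* n)) ℕ.+ n ℕ.* (n ℕ.+ 1))
                                          * (C ^ (n ℕ.* (n ℕ.+ 1)) * (u * B′)))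
        ≈⟨ *-cong sign-suc
                  (*-cong (^-congʳ a (a-exponent n)) (*-cong (^-congʳ C (C-exponent n)) ([c-a]*Bseq′ n))) ⟩
      sign (suc n) * (a ^ (suc n ℕ.* (suc n ℕ.+ 1)) * (C ^ (suc n ℕ.* (suc n ∸ 1)) * Bseq a c d (suc n))) ∎
      where
      index : ∀ n → 2 ℕ.* suc n ≡.≡ suc (suc (2 ℕ.* n))
      index = solve-∀
      k+r : ∀ n → suc (2 ℕ.* n) ℕ.+ n ℕ.* (n ∸ 1) ≡.≡ n ℕ.* (n ℕ.+ 1) ℕ.+ 1
      k+r zero    = ≡.refl
      k+r (suc n) = k+r-suc n
        where
        k+r-suc : ∀ n → suc (2 ℕ.* suc n) ℕ.+ suc n ℕ.* n ≡.≡ suc n ℕ.* (suc n ℕ.+ 1) ℕ.+ 1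
        k+r-suc = solve-∀
      a-exponent : ∀ n → suc (suc (2 ℕ.* n)) ℕ.+ n ℕ.* (n ℕ.+ 1) ≡.≡ suc n ℕ.* (suc n ℕ.+ 1)
      a-exponent = solve-∀
      C-exponent : ∀ n → n ℕ.* (n ℕ.+ 1) ≡.≡ suc n ℕ.* n
      C-exponent = solve-∀
      double : ∀ n → 2 ℕ.* n ≡.≡ n ℕ.+ n
      double = solve-∀
      sign-suc : sign (suc (2 ℕ.* n)) * sign n ≈ sign (suc n)
      sign-suc = begin
        - sign (2 ℕ.* n) * sign n    ≈⟨ *-congʳ (-‿cong (trans (reflexive (≡.cong sign (double n))) (sign-even n))) ⟩
        - 1# * sign n                ≈⟨ solve 1 (λ s → :- con (+ 1) :* s := :- s) refl (sign n) ⟩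
        - sign n                     ∎

  hankel-closedForm : ∀ n a b c d E → FunctionalEquation a b c d E → (∀ m → ¬ hankel m E ≈ 0#) →
                      OddHankel n a c d E × EvenHankel n a c d E
  hankel-closedForm zero a b c d E E-eq H≉0 =
      trans (hankel-1 E) (trans E₀≈a (solve 1 (λ a → a := (a :* con (+ 1)) :* (con (+ 1) :* con (+ 1))) refl a))
    , solve 0 (con (+ 1) := con (+ 1) :* (con (+ 1) :* (con (+ 1) :* con (+ 1)))) refl
    where open ContinuedFraction.Step F a b c d E E-eq using (E₀≈a)
  hankel-closedForm (suc n) a b c d E E-eq H≉0 = odd , even
    where open InductionStep n (hankel-closedForm n) a b c d E E-eq H≉0

open import Data.Nat using (_*_; _+_)
open import Data.Product using (_×_)
open Field using (Carrier)

theorem1 : ∀ {κ ℓ : Level} (F : Field κ ℓ) → (a b c d : Carrier F) → (E : FieldTheory.Series F) →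
  -- E = a / (E x² (d x² - b x - 1) + c x² + b x + 1), denominator (constant term 1) cleared
  FieldTheory._≈ₛ_ F (FieldTheory._⊗_ F E (FieldTheory._⊕_ F (FieldTheory._⊗_ F E (FieldTheory.poly F (Field.0# F) (Field.0# F) (Field.-_ F (Field.1# F)) (Field.-_ F b) d)) (FieldTheory.poly F (Field.1# F) b c (Field.0# F) (Field.0# F)))) (FieldTheory.constS F a) →
  (∀ n → ¬ (Field._≈_ F (FieldTheory.hankel F n E) (Field.0# F))) →
  ∀ n →
    Field._≈_ F (FieldTheory.hankel F (2 * n + 1) E)
      (Field._*_ F (FieldTheory._^_ F a ((n + 1) * (n + 1)))
        (Field._*_ F (FieldTheory._^_ F (Field._-_ F (Field._+_ F c d) a) (n * n)) (FieldTheory.Bseq F a c d n)))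
    ×
    Field._≈_ F (FieldTheory.hankel F (2 * n) E)
      (Field._*_ F (FieldTheory.sign F n)
        (Field._*_ F (FieldTheory._^_ F a (n * (n + 1)))
          (Field._*_ F (FieldTheory._^_ F (Field._-_ F (Field._+_ F c d) a) (n * (n ∸ 1))) (FieldTheory.Bseq F a c d n))))
theorem1 F a b c d E functionalEquation H≉0 n = ClosedForm.hankel-closedForm F n a b c d E functionalEquation H≉0
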